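{- Fix an integer base $b\ge2$. Let $(w_i)_{i\in\mathbb{N}}$, $(v_i)_{i\in\mathbb{N}}$ be sequences of finite base-$b$ strings and let $W=w_1v_1w_2v_2\cdots$. Suppose that $|v_1\cdots v_i|=o(|w_1v_1\cdots w_{i-1}v_{i-1}w_i|)$ as $i\to\infty$, and that there are a sequence $(\epsilon_i)$ of positive reals tending to $0$, a sequence $(k_i)$ of positive integers tending to infinity, and a sequence $(m_i)$ of positive integers tending to infinity such that \[ \lim_{i\to\infty}\frac{\sum_{j\le i}m_j}{|w_1\cdots w_{i-1}|}=0,\qquad \lim_{i\to\infty}\left(\frac{2k_i}{m_i-k_i+1}+b^{k_i}\epsilon_i\right)=0, \] and each $w_i$ is $(\epsilon_i,k_i,m_i)$-normal. Then $W$ is normal in base $b$.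
   Context: $\nu_u(w)$ is the number of occurrences of the string $u$ as a contiguous substring of $w$. A finite string $w$ is $(\epsilon,u)$-normal if $|w|\ge|u|$ and $\left|\frac{\nu_u(w)}{|w|-|u|+1}-b^{ -|u|}\right|\le\epsilon$; it is $(\epsilon,k)$-normal if it is $(\epsilon,u)$-normal for every base-$b$ string $u$ with $|u|=k$; it is $(\epsilon,k,m)$-normal if every prefix of $w$ whose length is a positive multiple of $m$ is $(\epsilon,k)$-normal. An infinite string $W$ is normal in base $b$ if for every finite string $u$, $\nu_u(W^{(n)})/n\to b^{ -|u|}$, where $W^{(n)}$ is the length-$n$ prefix.
   Formalization: The sequence $(\epsilon_i)$ takes values in the positive rationals rather than the positive reals. -}

module Defs where

open import Data.Nat as ℕ using (ℕ; zero; suc; _^_; _∸_)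
open import Data.Integer as ℤ using (ℤ; +_; +[1+_]; -[1+_])
open import Data.Rational as ℚ using (ℚ; mkℚ; 0ℚ; 1ℚ; _÷_; _-_; _+_; _*_; ∣_∣; _≤_; _<_)
open import Data.Fin using (Fin; _≟_)
open import Data.List using (List; []; _∷_; length; take; _++_)
open import Data.Product using (Σ; _×_; ∃-syntax)
open import Data.Bool using (Bool; true; false; _∧_; if_then_else_)
open import Relation.Nullary using (¬_)
open import Relation.Nullary.Decidable using (⌊_⌋)
open import Relation.Binary.PropositionalEquality using (_≡_)

ℕ→ℚ : ℕ → ℚ
ℕ→ℚ n = + n ℚ./ 1

ℤ→ℚ : ℤ → ℚ
ℤ→ℚ z = z ℚ./ 1

-- total division on ℚ: p / q, with the (never used) junk value 0 when q = 0.
-- Every use in the statement is guarded by an explicit "q ≢ 0" hypothesis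
-- or an obviously positive denominator.
divQ : ℚ → ℚ → ℚ
divQ p (mkℚ (+ 0) _ _) = 0ℚ
divQ p q@(mkℚ +[1+ n ] _ _) = p ÷ q
divQ p q@(mkℚ -[1+ n ] _ _) = p ÷ q

Str : ℕ → Set
Str b = List (Fin b)

isPrefix : ∀ {b} → Str b → Str b → Bool
isPrefix [] w = true
isPrefix (x ∷ u) [] = false
isPrefix (x ∷ u) (y ∷ w) = ⌊ x ≟ y ⌋ ∧ isPrefix u w

-- ν_u(w): number of occurrences of u as a contiguous substring of w,
-- i.e. the number of positions 0 ≤ i ≤ |w| - |u| at which u starts.
ν : ∀ {b} → Str b → Str b → ℕ
ν u [] = if isPrefix u [] then 1 else 0
ν u (x ∷ w) = (if isPrefix u (x ∷ w) then 1 else 0) ℕ.+ ν u w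

εuNormal : ∀ {b} → ℚ → Str b → Str b → Set
εuNormal {b} ε u w =
  (length u ℕ.≤ length w) ×
  (∣ divQ (ℕ→ℚ (ν u w)) (ℕ→ℚ (suc (length w ∸ length u)))
      - divQ 1ℚ (ℕ→ℚ (b ^ length u)) ∣ ≤ ε)

εkNormal : ∀ {b} → ℚ → ℕ → Str b → Set
εkNormal {b} ε k w = (u : Str b) → length u ≡ k → εuNormal ε u w

εkmNormal : ∀ {b} → ℚ → ℕ → ℕ → Str b → Set
εkmNormal {b} ε k m w =
  (t : ℕ) → suc t ℕ.* m ℕ.≤ length w → εkNormal ε k (take (suc t ℕ.* m) w)

sumBelow : (ℕ → ℕ) → ℕ → ℕ
sumBelow f zero = 0
sumBelow f (suc i) = sumBelow f i ℕ.+ f i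

concatBelow : ∀ {b} → (ℕ → Str b) → ℕ → Str b
concatBelow f zero = []
concatBelow f (suc i) = concatBelow f i ++ f i

-- W = w₀ v₀ w₁ v₁ ⋯ ; the prefix w₀ v₀ ⋯ w_{i-1} v_{i-1}
blocksW : ∀ {b} → (ℕ → Str b) → (ℕ → Str b) → ℕ → Str b
blocksW w v = concatBelow (λ j → w j ++ v j)

-- a ℚ-sequence tends to 0, where the i-th term need only be defined
-- (Def i) eventually
TendsTo0 : (Def : ℕ → Set) → (ℕ → ℚ) → Set
TendsTo0 Def a = (δ : ℚ) → 0ℚ < δ →
  ∃[ N ] ((i : ℕ) → N ℕ.≤ i → Def i × (∣ a i ∣ ≤ δ))

TendsToInf : (ℕ → ℕ) → Set
TendsToInf k = (K : ℕ) → ∃[ N ] ((i : ℕ) → N ℕ.≤ i → K ℕ.≤ k i)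

InfiniteW : ∀ {b} → (ℕ → Str b) → (ℕ → Str b) → Set
InfiniteW w v = (n : ℕ) → ∃[ i ] (n ℕ.≤ length (blocksW w v i))

-- W is normal in base b: for every finite u, ν_u(W^(n))/n → b^{-|u|}.
-- W^(n) = take n (blocksW w v i) for any i with n ≤ |blocksW w v i|.
NormalW : (b : ℕ) → (ℕ → Str b) → (ℕ → Str b) → Set
NormalW b w v = (u : Str b) → (δ : ℚ) → 0ℚ < δ →
  ∃[ N ] ((n : ℕ) → N ℕ.≤ n → suc 0 ℕ.≤ n → (i : ℕ) → n ℕ.≤ length (blocksW w v i) →
    ∣ divQ (ℕ→ℚ (ν u (take n (blocksW w v i)))) (ℕ→ℚ n)
      - divQ 1ℚ (ℕ→ℚ (b ^ length u)) ∣ ≤ δ)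

{-# OPTIONS --safe #-}
-- Fix a pattern u of length ℓ and a scale E, and call a string s typical with defect J when
-- ν_u(s)/|s| lies within (b^ℓ + 2)/(b^ℓ E) + J/|s| of b^(−ℓ). Every s is typical with defect
-- |s| + 1, and gluing two typical strings adds at most ℓ + 1 to the defect, since concatenation
-- creates at most ℓ occurrences and destroys at most one. A prefix of w_i whose length is a
-- multiple of m_i is typical with defect 0: summing its (ε_i, k_i)-normality over the b^(k_i − ℓ)
-- extensions of u to length k_i counts all but at most k_i occurrences of u, and
-- 2k_i/(m_i − k_i + 1) + b^(k_i) ε_i → 0 controls both errors. So past some index J₀ every
-- prefix of w_i is typical with defect m_i + ℓ + 1, and a prefix of W ending inside block i is
-- typical with defect O(Σ_{j<J₀} |w_j| + Σ_{j≤i} (|v_j| + m_j)), which is o(n) by the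
-- hypotheses on |v_1 ⋯ v_i| and Σ_{j≤i} m_j.
module Submission where

open import Defs
open import Data.Nat using (ℕ; NonZero)

module Approximation where
  open import Data.Nat hiding (_≟_)
  open import Data.Nat.Properties hiding (_≟_)
  open import Data.Product using (_×_; _,_)
  open import Relation.Binary.PropositionalEquality
  open import Algebra.Properties.CommutativeSemigroup +-commutativeSemigroup using (interchange)
  open import Data.Nat.Solver using (module +-*-Solver)
  open +-*-Solver

  Near : ℕ → ℕ → ℕ → Set
  Near x y e = x ≤ y + e × y ≤ x + e

  Near-weaken : ∀ {x y e e′} → e ≤ e′ → Near x y e → Near x y e′
  Near-weaken e≤e′ (x≤ , y≤) = ≤-trans x≤ (+-monoʳ-≤ _ e≤e′) , ≤-trans y≤ (+-monoʳ-≤ _ e≤e′)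

  Near-resp : ∀ {x y e x′ y′ e′} → x ≡ x′ → y ≡ y′ → e ≡ e′ → Near x y e → Near x′ y′ e′
  Near-resp refl refl refl near = near

  Near-trans : ∀ {x y z e f} → Near x y e → Near y z f → Near x z (e + f)
  Near-trans {x} {y} {z} {e} {f} (x≤y+e , y≤x+e) (y≤z+f , z≤y+f) = x≤z+e+f , z≤x+e+f
    where
    open ≤-Reasoning
    x≤z+e+f : x ≤ z + (e + f)
    x≤z+e+f = begin
      x           ≤⟨ x≤y+e ⟩
      y + e       ≤⟨ +-monoˡ-≤ e y≤z+f ⟩
      z + f + e   ≡⟨ solve 3 (λ z e f → z :+ f :+ e := z :+ (e :+ f)) refl z e f ⟩
      z + (e + f) ∎
    z≤x+e+f : z ≤ x + (e + f)
    z≤x+e+f = begin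
      z           ≤⟨ z≤y+f ⟩
      y + f       ≤⟨ +-monoˡ-≤ f y≤x+e ⟩
      x + e + f   ≡⟨ +-assoc x e f ⟩
      x + (e + f) ∎

  Near-+ : ∀ {x y e x′ y′ e′} → Near x y e → Near x′ y′ e′ → Near (x + x′) (y + y′) (e + e′)
  Near-+ {x} {y} {e} {x′} {y′} {e′} (x≤ , y≤) (x′≤ , y′≤) =
    ≤-trans (+-mono-≤ x≤ x′≤) (≤-reflexive (interchange y e y′ e′)) ,
    ≤-trans (+-mono-≤ y≤ y′≤) (≤-reflexive (interchange x e x′ e′))

  Near-*ʳ : ∀ {x y e} c → Near x y e → Near (x * c) (y * c) (e * c)
  Near-*ʳ {x} {y} {e} c (x≤ , y≤) =
    ≤-trans (*-monoˡ-≤ c x≤) (≤-reflexive (*-distribʳ-+ c y e)) ,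
    ≤-trans (*-monoˡ-≤ c y≤) (≤-reflexive (*-distribʳ-+ c x e))

  Near-*-cancelˡ : ∀ {x y e} c .{{_ : NonZero c}} → Near (c * x) (c * y) (c * e) → Near x y e
  Near-*-cancelˡ {x} {y} {e} c (x≤ , y≤) =
    *-cancelˡ-≤ c (≤-trans x≤ (≤-reflexive (sym (*-distribˡ-+ c y e)))) ,
    *-cancelˡ-≤ c (≤-trans y≤ (≤-reflexive (sym (*-distribˡ-+ c x e))))

module Sums where
  open import Data.Nat hiding (_≟_)
  open import Data.Nat.Properties hiding (_≟_)
  open import Relation.Nullary using (yes; no)
  open import Relation.Binary.PropositionalEquality

  sumBelow-cong : ∀ {f g : ℕ → ℕ} → (∀ j → f j ≡ g j) → ∀ i → sumBelow f i ≡ sumBelow g i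
  sumBelow-cong f≡g zero = refl
  sumBelow-cong f≡g (suc i) = cong₂ _+_ (sumBelow-cong f≡g i) (f≡g i)

  sumBelow-mono-≤ : ∀ {f g : ℕ → ℕ} → (∀ j → f j ≤ g j) → ∀ i → sumBelow f i ≤ sumBelow g i
  sumBelow-mono-≤ f≤g zero = z≤n
  sumBelow-mono-≤ f≤g (suc i) = +-mono-≤ (sumBelow-mono-≤ f≤g i) (f≤g i)

  sumBelow-monoʳ-≤ : ∀ f {i i′} → i ≤ i′ → sumBelow f i ≤ sumBelow f i′
  sumBelow-monoʳ-≤ f i≤i′ = go (≤⇒≤′ i≤i′)
    where
    go : ∀ {i i′} → i ≤′ i′ → sumBelow f i ≤ sumBelow f i′
    go ≤′-refl = ≤-refl
    go (≤′-step i≤′i′) = ≤-trans (go i≤′i′) (m≤m+n _ _)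

  sumBelow-vanishing : ∀ {f g : ℕ → ℕ} N → (∀ j → f j ≤ g j) → (∀ j → N ≤ j → f j ≡ 0) →
    ∀ i → sumBelow f i ≤ sumBelow g N
  sumBelow-vanishing N f≤g f≡0 zero = z≤n
  sumBelow-vanishing {f} {g} N f≤g f≡0 (suc i) with i <? N
  ... | yes i<N = ≤-trans (sumBelow-mono-≤ f≤g (suc i)) (sumBelow-monoʳ-≤ g i<N)
  ... | no i≮N = begin
    sumBelow f i + f i ≡⟨ cong (sumBelow f i +_) (f≡0 i (≮⇒≥ i≮N)) ⟩
    sumBelow f i + 0   ≡⟨ +-identityʳ _ ⟩
    sumBelow f i       ≤⟨ sumBelow-vanishing N f≤g f≡0 i ⟩
    sumBelow g N       ∎
    where open ≤-Reasoning

  ≤-sumBelow : ∀ {f : ℕ → ℕ} → (∀ j → 1 ≤ f j) → ∀ i → i ≤ sumBelow f i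
  ≤-sumBelow 1≤f zero = z≤n
  ≤-sumBelow 1≤f (suc i) = ≤-trans (≤-reflexive (+-comm 1 i)) (+-mono-≤ (≤-sumBelow 1≤f i) (1≤f i))

module Lists where
  open import Data.Nat hiding (_≟_)
  open import Data.Nat.Properties hiding (_≟_)
  open import Data.List using (List; []; _∷_; length; take; drop; _++_)
  open import Data.List.Properties using (length-++; take-all; ++-identityʳ; take-[])
  open import Data.Product using (_×_; _,_; ∃-syntax)
  open import Relation.Nullary using (yes; no)
  open import Relation.Binary.PropositionalEquality

  module _ {A : Set} where

    length-take≡n : ∀ n (xs : List A) → n ≤ length xs → length (take n xs) ≡ n
    length-take≡n zero xs _ = refl
    length-take≡n (suc n) (x ∷ xs) (s≤s n≤) = cong suc (length-take≡n n xs n≤)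

    length-take≤n : ∀ n (xs : List A) → length (take n xs) ≤ n
    length-take≤n zero xs = z≤n
    length-take≤n (suc n) [] = z≤n
    length-take≤n (suc n) (x ∷ xs) = s≤s (length-take≤n n xs)

    take-++ : ∀ n (xs ys : List A) → take n (xs ++ ys) ≡ take n xs ++ take (n ∸ length xs) ys
    take-++ zero [] ys = refl
    take-++ zero (x ∷ xs) ys = refl
    take-++ (suc n) [] ys = refl
    take-++ (suc n) (x ∷ xs) ys = cong (x ∷_) (take-++ n xs ys)

    take-++-≤ : ∀ n (xs ys : List A) → n ≤ length xs → take n (xs ++ ys) ≡ take n xs
    take-++-≤ n xs ys n≤ = begin
      take n (xs ++ ys)                        ≡⟨ take-++ n xs ys ⟩
      take n xs ++ take (n ∸ length xs) ys     ≡⟨ cong (λ t → take n xs ++ take t ys) (m≤n⇒m∸n≡0 n≤) ⟩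
      take n xs ++ []                          ≡⟨ ++-identityʳ _ ⟩
      take n xs                                ∎
      where open ≡-Reasoning

    take-++-≥ : ∀ n (xs ys : List A) → length xs ≤ n → take n (xs ++ ys) ≡ xs ++ take (n ∸ length xs) ys
    take-++-≥ n xs ys ≤n = trans (take-++ n xs ys) (cong (_++ take (n ∸ length xs) ys) (take-all n xs ≤n))

    take-+ : ∀ a c (xs : List A) → take (a + c) xs ≡ take a xs ++ take c (drop a xs)
    take-+ zero c xs = refl
    take-+ (suc a) c [] = sym (take-[] c)
    take-+ (suc a) c (x ∷ xs) = cong (x ∷_) (take-+ a c xs)

  module _ {b : ℕ} where

    length-concatBelow : ∀ (f : ℕ → Str b) i → length (concatBelow f i) ≡ sumBelow (λ j → length (f j)) i
    length-concatBelow f zero = refl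
    length-concatBelow f (suc i) = trans (length-++ (concatBelow f i)) (cong (_+ length (f i)) (length-concatBelow f i))

    take-concatBelow : ∀ (f : ℕ → Str b) i n → n ≤ length (concatBelow f i) →
      ∃[ j ] ∃[ r ] (r ≤ length (f j) × n ≡ length (concatBelow f j) + r ×
                     take n (concatBelow f i) ≡ concatBelow f j ++ take r (f j))
    take-concatBelow f zero zero _ = 0 , 0 , z≤n , refl , refl
    take-concatBelow f (suc i) n n≤ with n ≤? length (concatBelow f i)
    ... | yes n≤C with take-concatBelow f i n n≤C
    ...   | j , r , r≤ , n≡ , eq = j , r , r≤ , n≡ , trans (take-++-≤ n (concatBelow f i) (f i) n≤C) eq
    take-concatBelow f (suc i) n n≤ | no n≰C =
      i , n ∸ C , r≤ , sym (m+[n∸m]≡n C≤n) , take-++-≥ n (concatBelow f i) (f i) C≤n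
      where
      C : ℕ
      C = length (concatBelow f i)
      C≤n : C ≤ n
      C≤n = <⇒≤ (≰⇒> n≰C)
      r≤ : n ∸ C ≤ length (f i)
      r≤ = ≤-trans (∸-monoˡ-≤ C (≤-trans n≤ (≤-reflexive (length-++ (concatBelow f i))))) (≤-reflexive (m+n∸m≡n C _))

module RationalBounds where
  import Data.Nat as ℕ
  import Data.Nat.Properties as ℕₚ
  open import Data.Nat using (ℕ; zero; suc; z≤n; s≤s)
  open import Data.Integer as ℤ using (+_)
  import Data.Integer.Properties as ℤₚ
  open import Data.Rational as ℚ
    using (ℚ; mkℚ; 0ℚ; 1ℚ; _+_; _*_; _-_; -_; _≤_; _<_; ∣_∣; 1/_; toℚᵘ; NonNegative; Positive)
  open import Data.Rational.Properties
  import Data.Rational.Unnormalised as ℚᵘ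
  import Data.Rational.Unnormalised.Properties as ℚᵘₚ
  import Data.Nat.Coprimality as Coprimality
  open import Data.Rational.Solver using (module +-*-Solver)
  open +-*-Solver
  open import Data.Product using (_×_; _,_; proj₁; proj₂; ∃-syntax)
  open import Data.Sum using (inj₁; inj₂)
  open import Relation.Nullary using (¬_; contradiction)
  open import Relation.Binary.PropositionalEquality
  open Approximation using (Near)

  ℕ→ℚ≡mkℚ : ∀ n → ℕ→ℚ n ≡ mkℚ (+ n) 0 (Coprimality.sym (Coprimality.1-coprimeTo n))
  ℕ→ℚ≡mkℚ n = normalize-coprime (Coprimality.sym (Coprimality.1-coprimeTo n))

  toℚᵘ-ℕ→ℚ : ∀ n → toℚᵘ (ℕ→ℚ n) ≡ ℚᵘ.mkℚᵘ (+ n) 0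
  toℚᵘ-ℕ→ℚ n = cong toℚᵘ (ℕ→ℚ≡mkℚ n)

  ℕ→ℚ-homo-+ : ∀ a b → ℕ→ℚ (a ℕ.+ b) ≡ ℕ→ℚ a + ℕ→ℚ b
  ℕ→ℚ-homo-+ a b = toℚᵘ-injective (begin
    toℚᵘ (ℕ→ℚ (a ℕ.+ b))                       ≡⟨ toℚᵘ-ℕ→ℚ (a ℕ.+ b) ⟩
    ℚᵘ.mkℚᵘ (+ (a ℕ.+ b)) 0                    ≈⟨ ℚᵘ.*≡* (cong (ℤ._* + 1) (sym (cong₂ ℤ._+_ (ℤₚ.*-identityʳ (+ a)) (ℤₚ.*-identityʳ (+ b))))) ⟩
    ℚᵘ.mkℚᵘ (+ a) 0 ℚᵘ.+ ℚᵘ.mkℚᵘ (+ b) 0      ≡⟨ sym (cong₂ ℚᵘ._+_ (toℚᵘ-ℕ→ℚ a) (toℚᵘ-ℕ→ℚ b)) ⟩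
    toℚᵘ (ℕ→ℚ a) ℚᵘ.+ toℚᵘ (ℕ→ℚ b)            ≈⟨ ℚᵘₚ.≃-sym (toℚᵘ-homo-+ (ℕ→ℚ a) (ℕ→ℚ b)) ⟩
    toℚᵘ (ℕ→ℚ a + ℕ→ℚ b)                      ∎)
    where open ℚᵘₚ.≃-Reasoning

  ℕ→ℚ-homo-* : ∀ a b → ℕ→ℚ (a ℕ.* b) ≡ ℕ→ℚ a * ℕ→ℚ b
  ℕ→ℚ-homo-* a b = toℚᵘ-injective (begin
    toℚᵘ (ℕ→ℚ (a ℕ.* b))                       ≡⟨ toℚᵘ-ℕ→ℚ (a ℕ.* b) ⟩
    ℚᵘ.mkℚᵘ (+ (a ℕ.* b)) 0                    ≈⟨ ℚᵘ.*≡* (trans (ℤₚ.*-identityʳ _) (trans (ℤₚ.pos-* a b) (sym (ℤₚ.*-identityʳ _)))) ⟩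
    ℚᵘ.mkℚᵘ (+ a) 0 ℚᵘ.* ℚᵘ.mkℚᵘ (+ b) 0      ≡⟨ sym (cong₂ ℚᵘ._*_ (toℚᵘ-ℕ→ℚ a) (toℚᵘ-ℕ→ℚ b)) ⟩
    toℚᵘ (ℕ→ℚ a) ℚᵘ.* toℚᵘ (ℕ→ℚ b)            ≈⟨ ℚᵘₚ.≃-sym (toℚᵘ-homo-* (ℕ→ℚ a) (ℕ→ℚ b)) ⟩
    toℚᵘ (ℕ→ℚ a * ℕ→ℚ b)                      ∎)
    where open ℚᵘₚ.≃-Reasoning

  ℕ→ℚ-mono-≤ : ∀ {a b} → a ℕ.≤ b → ℕ→ℚ a ≤ ℕ→ℚ b
  ℕ→ℚ-mono-≤ {a} {b} a≤b rewrite ℕ→ℚ≡mkℚ a | ℕ→ℚ≡mkℚ b = ℚ.*≤* (ℤₚ.*-monoʳ-≤-nonNeg (+ 1) (ℤ.+≤+ a≤b))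

  ℕ→ℚ-cancel-≤ : ∀ {a b} → ℕ→ℚ a ≤ ℕ→ℚ b → a ℕ.≤ b
  ℕ→ℚ-cancel-≤ {a} {b} a≤b rewrite ℕ→ℚ≡mkℚ a | ℕ→ℚ≡mkℚ b with a≤b
  ... | ℚ.*≤* a≤b′ = ℤₚ.drop‿+≤+ (subst₂ ℤ._≤_ (ℤₚ.*-identityʳ (+ a)) (ℤₚ.*-identityʳ (+ b)) a≤b′)

  ℕ→ℚ-nonNeg : ∀ n → NonNegative (ℕ→ℚ n)
  ℕ→ℚ-nonNeg n = subst NonNegative (sym (ℕ→ℚ≡mkℚ n)) _

  ℕ→ℚ-pos : ∀ {n} → 1 ℕ.≤ n → Positive (ℕ→ℚ n)
  ℕ→ℚ-pos {suc n} _ = subst Positive (sym (ℕ→ℚ≡mkℚ (suc n))) _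

  ℕ→ℚ*divQ : ∀ p n → 1 ℕ.≤ n → ℕ→ℚ n * divQ p (ℕ→ℚ n) ≡ p
  ℕ→ℚ*divQ p (suc n) _ rewrite ℕ→ℚ≡mkℚ (suc n) = begin
    q * (p * 1/ q)   ≡⟨ cong (q *_) (*-comm p (1/ q)) ⟩
    q * (1/ q * p)   ≡⟨ sym (*-assoc q (1/ q) p) ⟩
    q * 1/ q * p     ≡⟨ cong (_* p) (*-inverseʳ q) ⟩
    1ℚ * p           ≡⟨ *-identityˡ p ⟩
    p                ∎
    where
    open ≡-Reasoning
    q : ℚ
    q = mkℚ (+ suc n) 0 (Coprimality.sym (Coprimality.1-coprimeTo (suc n)))

  divQ-nonNeg : ∀ x n → NonNegative (divQ (ℕ→ℚ x) (ℕ→ℚ n))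
  divQ-nonNeg x zero rewrite ℕ→ℚ≡mkℚ zero = _
  divQ-nonNeg x (suc n) rewrite ℕ→ℚ≡mkℚ (suc n) =
    nonNeg*nonNeg⇒nonNeg (ℕ→ℚ x) {{ℕ→ℚ-nonNeg x}} (1/ mkℚ (+ suc n) 0 (Coprimality.sym (Coprimality.1-coprimeTo (suc n)))) {{_}}

  1/ℕ : ℕ → ℚ
  1/ℕ n = divQ 1ℚ (ℕ→ℚ n)

  1/ℕ-pos : ∀ {n} → 1 ℕ.≤ n → 0ℚ < 1/ℕ n
  1/ℕ-pos {n} 1≤n = *-cancelˡ-<-nonNeg (ℕ→ℚ n) {{ℕ→ℚ-nonNeg n}} (begin-strict
    ℕ→ℚ n * 0ℚ     ≡⟨ *-zeroʳ (ℕ→ℚ n) ⟩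
    0ℚ             <⟨ ℚ.*<* (ℤ.+<+ (s≤s z≤n)) ⟩
    1ℚ             ≡⟨ sym (ℕ→ℚ*divQ 1ℚ n 1≤n) ⟩
    ℕ→ℚ n * 1/ℕ n ∎)
    where open ≤-Reasoning

  1≤↧ₙ*p : ∀ p → 0ℚ < p → 1ℚ ≤ ℕ→ℚ (ℚ.↧ₙ p) * p
  1≤↧ₙ*p p@(mkℚ ℤ.+[1+ n ] d-1 _) _ = toℚᵘ-cancel-≤ (ℚᵘₚ.≤-respʳ-≃ (ℚᵘₚ.≃-sym (toℚᵘ-homo-* (ℕ→ℚ (suc d-1)) p))
    (subst (λ x → toℚᵘ 1ℚ ℚᵘ.≤ (x ℚᵘ.* toℚᵘ p)) (sym (toℚᵘ-ℕ→ℚ (suc d-1))) (ℚᵘ.*≤* (ℤ.+≤+ (s≤s d-1≤)))))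
    where
    open ℕₚ.≤-Reasoning
    d-1≤ : d-1 ℕ.+ 0 ℕ.+ 0 ℕ.≤ (n ℕ.+ d-1 ℕ.* suc n) ℕ.* 1
    d-1≤ = begin
      d-1 ℕ.+ 0 ℕ.+ 0               ≡⟨ trans (ℕₚ.+-identityʳ _) (ℕₚ.+-identityʳ d-1) ⟩
      d-1                           ≤⟨ ℕₚ.m≤m*n d-1 (suc n) ⟩
      d-1 ℕ.* suc n                 ≤⟨ ℕₚ.m≤n+m _ n ⟩
      n ℕ.+ d-1 ℕ.* suc n           ≡⟨ sym (ℕₚ.*-identityʳ _) ⟩
      (n ℕ.+ d-1 ℕ.* suc n) ℕ.* 1   ∎
  1≤↧ₙ*p (mkℚ (+ zero) _ _) (ℚ.*<* (ℤ.+<+ ()))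
  1≤↧ₙ*p (mkℚ ℤ.-[1+ _ ] _ _) (ℚ.*<* ())

  archimedean : ∀ δ → 0ℚ < δ → ∃[ D ] (1 ℕ.≤ D × 1/ℕ D ≤ δ)
  archimedean δ 0<δ = D , s≤s z≤n ,
    *-cancelˡ-≤-pos (ℕ→ℚ D) {{ℕ→ℚ-pos {D} (s≤s z≤n)}}
      (subst (_≤ ℕ→ℚ D * δ) (sym (ℕ→ℚ*divQ 1ℚ D (s≤s z≤n))) (1≤↧ₙ*p δ 0<δ))
    where D = ℚ.↧ₙ δ

  Nearℚ : ℚ → ℚ → ℚ → Set
  Nearℚ x y e = x ≤ y + e × y ≤ x + e

  Nearℚ-resp : ∀ {x y e x′ y′ e′} → x ≡ x′ → y ≡ y′ → e ≡ e′ → Nearℚ x y e → Nearℚ x′ y′ e′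
  Nearℚ-resp refl refl refl near = near

  Nearℚ-weaken : ∀ {x y e e′} → e ≤ e′ → Nearℚ x y e → Nearℚ x y e′
  Nearℚ-weaken {x} {y} e≤e′ (x≤ , y≤) = ≤-trans x≤ (+-monoʳ-≤ y e≤e′) , ≤-trans y≤ (+-monoʳ-≤ x e≤e′)

  Nearℚ-*ˡ : ∀ {x y e} r → NonNegative r → Nearℚ x y e → Nearℚ (r * x) (r * y) (r * e)
  Nearℚ-*ˡ {x} {y} {e} r r≥0 (x≤ , y≤) =
    ≤-trans (*-monoˡ-≤-nonNeg r {{r≥0}} x≤) (≤-reflexive (*-distribˡ-+ r y e)) ,
    ≤-trans (*-monoˡ-≤-nonNeg r {{r≥0}} y≤) (≤-reflexive (*-distribˡ-+ r x e))

  Nearℚ-*-cancelˡ : ∀ {x y e} r → Positive r → Nearℚ (r * x) (r * y) (r * e) → Nearℚ x y e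
  Nearℚ-*-cancelˡ {x} {y} {e} r r>0 (x≤ , y≤) =
    *-cancelˡ-≤-pos {x} {y + e} r {{r>0}} (≤-trans x≤ (≤-reflexive (sym (*-distribˡ-+ r y e)))) ,
    *-cancelˡ-≤-pos {y} {x + e} r {{r>0}} (≤-trans y≤ (≤-reflexive (sym (*-distribˡ-+ r x e))))

  p≤∣p∣ : ∀ p → p ≤ ∣ p ∣
  p≤∣p∣ p@(mkℚ (+ n) _ _) = ≤-refl
  p≤∣p∣ p@(mkℚ ℤ.-[1+ n ] _ _) = ≤-trans (nonPositive⁻¹ p) (0≤∣p∣ p)

  x-y≤e⇒x≤y+e : ∀ {x y e} → x - y ≤ e → x ≤ y + e
  x-y≤e⇒x≤y+e {x} {y} {e} x-y≤e =
    subst₂ _≤_ (solve 2 (λ x y → (x :- y) :+ y := x) refl x y) (+-comm e y) (+-monoˡ-≤ y x-y≤e)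

  x≤y+e⇒x-y≤e : ∀ {x y e} → x ≤ y + e → x - y ≤ e
  x≤y+e⇒x-y≤e {x} {y} {e} x≤y+e =
    subst (x - y ≤_) (solve 2 (λ y e → y :+ e :- y := e) refl y e) (+-monoˡ-≤ (- y) x≤y+e)

  ∣x-y∣≤e⇒Nearℚ : ∀ {x y e} → ∣ x - y ∣ ≤ e → Nearℚ x y e
  ∣x-y∣≤e⇒Nearℚ {x} {y} ∣x-y∣≤e =
    x-y≤e⇒x≤y+e (≤-trans (p≤∣p∣ (x - y)) ∣x-y∣≤e) ,
    x-y≤e⇒x≤y+e (≤-trans (p≤∣p∣ (y - x)) (subst (_≤ _) (swap-∣-∣ x y) ∣x-y∣≤e))
    where
    swap-∣-∣ : ∀ x y → ∣ x - y ∣ ≡ ∣ y - x ∣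
    swap-∣-∣ x y = trans (sym (∣-p∣≡∣p∣ (x - y))) (cong ∣_∣ (solve 2 (λ x y → :- (x :- y) := y :- x) refl x y))

  Nearℚ⇒∣x-y∣≤e : ∀ {x y e} → Nearℚ x y e → ∣ x - y ∣ ≤ e
  Nearℚ⇒∣x-y∣≤e {x} {y} {e} (x≤ , y≤) with ∣p∣≡p∨∣p∣≡-p (x - y)
  ... | inj₁ ∣x-y∣≡x-y = subst (_≤ e) (sym ∣x-y∣≡x-y) (x≤y+e⇒x-y≤e x≤)
  ... | inj₂ ∣x-y∣≡y-x = subst (_≤ e) (sym (trans ∣x-y∣≡y-x (solve 2 (λ x y → :- (x :- y) := y :- x) refl x y)))
                                 (x≤y+e⇒x-y≤e y≤)

  Near⇒Nearℚ : ∀ {x y e} → Near x y e → Nearℚ (ℕ→ℚ x) (ℕ→ℚ y) (ℕ→ℚ e)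
  Near⇒Nearℚ {x} {y} {e} (x≤ , y≤) =
    subst (_ ≤_) (ℕ→ℚ-homo-+ y e) (ℕ→ℚ-mono-≤ x≤) , subst (_ ≤_) (ℕ→ℚ-homo-+ x e) (ℕ→ℚ-mono-≤ y≤)

  Nearℚ⇒Near : ∀ {x y e} → Nearℚ (ℕ→ℚ x) (ℕ→ℚ y) (ℕ→ℚ e) → Near x y e
  Nearℚ⇒Near {x} {y} {e} (x≤ , y≤) =
    ℕ→ℚ-cancel-≤ (subst (_ ≤_) (sym (ℕ→ℚ-homo-+ y e)) x≤) , ℕ→ℚ-cancel-≤ (subst (_ ≤_) (sym (ℕ→ℚ-homo-+ x e)) y≤)

  ℕ→ℚ-homo-*³ : ∀ a b c → ℕ→ℚ (a ℕ.* b ℕ.* c) ≡ ℕ→ℚ a * ℕ→ℚ b * ℕ→ℚ c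
  ℕ→ℚ-homo-*³ a b c = trans (ℕ→ℚ-homo-* (a ℕ.* b) c) (cong (_* ℕ→ℚ c) (ℕ→ℚ-homo-* a b))

  frequency⇒Near : ∀ ν q B E ε → 1 ℕ.≤ q → 1 ℕ.≤ B → 1 ℕ.≤ E →
    ∣ divQ (ℕ→ℚ ν) (ℕ→ℚ q) - 1/ℕ B ∣ ≤ ε → ℕ→ℚ B * ε ≤ 1/ℕ E →
    Near (ν ℕ.* B ℕ.* E) (q ℕ.* E) q
  frequency⇒Near ν q B E ε 1≤q 1≤B 1≤E close Bε≤1/E = Nearℚ⇒Near
    (Nearℚ-resp (sym (ℕ→ℚ-homo-*³ ν B E)) (sym (ℕ→ℚ-homo-* q E)) refl
      (Nearℚ-weaken rε≤Q
        (Nearℚ-resp ra≡NBE rc≡QE refl (Nearℚ-*ˡ r r≥0 (∣x-y∣≤e⇒Nearℚ close)))))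
    where
    N Q Bq Eq r : ℚ
    N = ℕ→ℚ ν
    Q = ℕ→ℚ q
    Bq = ℕ→ℚ B
    Eq = ℕ→ℚ E
    r = Q * Bq * Eq
    r≥0 : NonNegative r
    r≥0 = nonNeg*nonNeg⇒nonNeg (Q * Bq) {{nonNeg*nonNeg⇒nonNeg Q {{ℕ→ℚ-nonNeg q}} Bq {{ℕ→ℚ-nonNeg B}}}} Eq {{ℕ→ℚ-nonNeg E}}
    ra≡NBE : r * divQ N Q ≡ N * Bq * Eq
    ra≡NBE = trans (solve 4 (λ Q B E a → Q :* B :* E :* a := Q :* a :* B :* E) refl Q Bq Eq (divQ N Q))
                   (cong (λ x → x * Bq * Eq) (ℕ→ℚ*divQ N q 1≤q))
    rc≡QE : r * 1/ℕ B ≡ Q * Eq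
    rc≡QE = trans (solve 4 (λ Q B E c → Q :* B :* E :* c := Q :* E :* (B :* c)) refl Q Bq Eq (1/ℕ B))
                  (trans (cong (Q * Eq *_) (ℕ→ℚ*divQ 1ℚ B 1≤B)) (*-identityʳ (Q * Eq)))
    rε≤Q : r * ε ≤ Q
    rε≤Q = begin
      r * ε               ≡⟨ solve 4 (λ Q B E ε → Q :* B :* E :* ε := Q :* E :* (B :* ε)) refl Q Bq Eq ε ⟩
      Q * Eq * (Bq * ε)   ≤⟨ *-monoˡ-≤-nonNeg (Q * Eq) {{nonNeg*nonNeg⇒nonNeg Q {{ℕ→ℚ-nonNeg q}} Eq {{ℕ→ℚ-nonNeg E}}}} Bε≤1/E ⟩
      Q * Eq * 1/ℕ E      ≡⟨ *-assoc Q Eq (1/ℕ E) ⟩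
      Q * (Eq * 1/ℕ E)    ≡⟨ cong (Q *_) (ℕ→ℚ*divQ 1ℚ E 1≤E) ⟩
      Q * 1ℚ              ≡⟨ *-identityʳ Q ⟩
      Q                   ∎
      where open ≤-Reasoning

  Near⇒frequency : ∀ V n β D → 1 ℕ.≤ n → 1 ℕ.≤ β → 1 ℕ.≤ D →
    Near (V ℕ.* β ℕ.* D) (n ℕ.* D) (n ℕ.* β) → ∣ divQ (ℕ→ℚ V) (ℕ→ℚ n) - 1/ℕ β ∣ ≤ 1/ℕ D
  Near⇒frequency V n β D 1≤n 1≤β 1≤D near = Nearℚ⇒∣x-y∣≤e (Nearℚ-*-cancelˡ r r>0
    (Nearℚ-resp (trans (ℕ→ℚ-homo-*³ V β D) (sym ra≡VβD)) (trans (ℕ→ℚ-homo-* n D) (sym rc≡nD))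
                (trans (ℕ→ℚ-homo-* n β) (sym ri≡nβ)) (Near⇒Nearℚ near)))
    where
    Vq Nq Bq Dq r : ℚ
    Vq = ℕ→ℚ V
    Nq = ℕ→ℚ n
    Bq = ℕ→ℚ β
    Dq = ℕ→ℚ D
    r = Nq * Bq * Dq
    r>0 : Positive r
    r>0 = pos*pos⇒pos (Nq * Bq) {{pos*pos⇒pos Nq {{ℕ→ℚ-pos 1≤n}} Bq {{ℕ→ℚ-pos 1≤β}}}} Dq {{ℕ→ℚ-pos 1≤D}}
    ra≡VβD : r * divQ Vq Nq ≡ Vq * Bq * Dq
    ra≡VβD = trans (solve 4 (λ N B D a → N :* B :* D :* a := N :* a :* B :* D) refl Nq Bq Dq (divQ Vq Nq))
                   (cong (λ x → x * Bq * Dq) (ℕ→ℚ*divQ Vq n 1≤n))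
    rc≡nD : r * 1/ℕ β ≡ Nq * Dq
    rc≡nD = trans (solve 4 (λ N B D c → N :* B :* D :* c := N :* D :* (B :* c)) refl Nq Bq Dq (1/ℕ β))
                  (trans (cong (Nq * Dq *_) (ℕ→ℚ*divQ 1ℚ β 1≤β)) (*-identityʳ (Nq * Dq)))
    ri≡nβ : r * 1/ℕ D ≡ Nq * Bq
    ri≡nβ = trans (*-assoc (Nq * Bq) Dq (1/ℕ D)) (trans (cong (Nq * Bq *_) (ℕ→ℚ*divQ 1ℚ D 1≤D)) (*-identityʳ (Nq * Bq)))

  ratio≤1/ℕ⇒ : ∀ x y E → 1 ℕ.≤ y → 1 ℕ.≤ E → divQ (ℕ→ℚ x) (ℕ→ℚ y) ≤ 1/ℕ E → x ℕ.* E ℕ.≤ y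
  ratio≤1/ℕ⇒ x y E 1≤y 1≤E x/y≤1/E = ℕ→ℚ-cancel-≤ (begin
    ℕ→ℚ (x ℕ.* E)          ≡⟨ ℕ→ℚ-homo-* x E ⟩
    X * Eq                 ≡⟨ cong (_* Eq) (sym (ℕ→ℚ*divQ X y 1≤y)) ⟩
    Y * divQ X Y * Eq      ≡⟨ solve 3 (λ Y a E → Y :* a :* E := Y :* E :* a) refl Y (divQ X Y) Eq ⟩
    Y * Eq * divQ X Y      ≤⟨ *-monoˡ-≤-nonNeg (Y * Eq) {{nonNeg*nonNeg⇒nonNeg Y {{ℕ→ℚ-nonNeg y}} Eq {{ℕ→ℚ-nonNeg E}}}} x/y≤1/E ⟩
    Y * Eq * 1/ℕ E         ≡⟨ *-assoc Y Eq (1/ℕ E) ⟩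
    Y * (Eq * 1/ℕ E)       ≡⟨ cong (Y *_) (ℕ→ℚ*divQ 1ℚ E 1≤E) ⟩
    Y * 1ℚ                 ≡⟨ *-identityʳ Y ⟩
    Y                      ∎)
    where
    open ≤-Reasoning
    X Y Eq : ℚ
    X = ℕ→ℚ x
    Y = ℕ→ℚ y
    Eq = ℕ→ℚ E

  eventually-ratio-≤ : ∀ (p q : ℕ → ℕ) →
    TendsTo0 (λ i → ¬ q i ≡ 0) (λ i → divQ (ℕ→ℚ (p i)) (ℕ→ℚ (q i))) →
    ∀ X → 1 ℕ.≤ X → ∃[ N ] (∀ i → N ℕ.≤ i → p i ℕ.* X ℕ.≤ q i)
  eventually-ratio-≤ p q p/q→0 X 1≤X with p/q→0 (1/ℕ X) (1/ℕ-pos 1≤X)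
  ... | N , tail = N , λ i N≤i → ratio≤1/ℕ⇒ (p i) (q i) X (nonzero (proj₁ (tail i N≤i))) 1≤X
                                   (≤-trans (p≤∣p∣ _) (proj₂ (tail i N≤i)))
    where
    nonzero : ∀ {n} → ¬ n ≡ 0 → 1 ℕ.≤ n
    nonzero {zero} n≢0 = contradiction refl n≢0
    nonzero {suc n} _ = s≤s z≤n

  tightness : ℕ → ℚ → ℕ → ℕ → ℚ
  tightness b ε k m = divQ (ℕ→ℚ (2 ℕ.* k)) (ℤ→ℚ (+ m ℤ.- + k ℤ.+ + 1)) + ℕ→ℚ (b ℕ.^ k) * ε

  tightness-bounds : ∀ b ε k m E → k ℕ.≤ m → 1 ℕ.≤ E → 0ℚ < ε → ∣ tightness b ε k m ∣ ≤ 1/ℕ E →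
    ℕ→ℚ (b ℕ.^ k) * ε ≤ 1/ℕ E × 2 ℕ.* k ℕ.* E ℕ.≤ suc (m ℕ.∸ k)
  tightness-bounds b ε k m E k≤m 1≤E 0<ε tight =
    ≤-trans (summand-≤ʳ 0≤ratio) sum≤ ,
    ratio≤1/ℕ⇒ (2 ℕ.* k) (suc (m ℕ.∸ k)) E (s≤s z≤n) 1≤E (≤-trans (summand-≤ˡ 0≤b^kε) sum≤)
    where
    m-k+1≡ : + m ℤ.- + k ℤ.+ + 1 ≡ + suc (m ℕ.∸ k)
    m-k+1≡ = trans (cong (ℤ._+ + 1) (trans (ℤₚ.[+m]-[+n]≡m⊖n m k) (ℤₚ.⊖-≥ k≤m))) (cong +_ (ℕₚ.+-comm (m ℕ.∸ k) 1))
    ratio : ℚ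
    ratio = divQ (ℕ→ℚ (2 ℕ.* k)) (ℕ→ℚ (suc (m ℕ.∸ k)))
    sum≤ : ratio + ℕ→ℚ (b ℕ.^ k) * ε ≤ 1/ℕ E
    sum≤ = ≤-trans (p≤∣p∣ _) (subst (λ z → ∣ divQ (ℕ→ℚ (2 ℕ.* k)) (ℤ→ℚ z) + ℕ→ℚ (b ℕ.^ k) * ε ∣ ≤ 1/ℕ E) m-k+1≡ tight)
    0≤ratio : 0ℚ ≤ ratio
    0≤ratio = nonNegative⁻¹ ratio {{divQ-nonNeg (2 ℕ.* k) (suc (m ℕ.∸ k))}}
    0≤b^kε : 0ℚ ≤ ℕ→ℚ (b ℕ.^ k) * ε
    0≤b^kε = nonNegative⁻¹ _ {{nonNeg*nonNeg⇒nonNeg (ℕ→ℚ (b ℕ.^ k)) {{ℕ→ℚ-nonNeg (b ℕ.^ k)}} ε {{ℚ.nonNegative (<⇒≤ 0<ε)}}}}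
    summand-≤ˡ : ∀ {a c} → 0ℚ ≤ c → a ≤ a + c
    summand-≤ˡ {a} {c} 0≤c = subst (_≤ a + c) (+-identityʳ a) (+-monoʳ-≤ a 0≤c)
    summand-≤ʳ : ∀ {a c} → 0ℚ ≤ a → c ≤ a + c
    summand-≤ʳ {a} {c} 0≤a = subst (_≤ a + c) (+-identityˡ c) (+-monoˡ-≤ c 0≤a)

module Occurrences where
  open import Data.Nat hiding (_≟_)
  open import Data.Nat.Properties hiding (_≟_)
  open import Data.Fin using (Fin; _≟_)
  import Data.Fin as Fin
  import Data.Fin.Properties as Finₚ
  open import Function using (_∘_)
  open import Algebra.Properties.CommutativeSemigroup +-commutativeSemigroup using (interchange)
  open import Data.List using ([]; _∷_; length; _++_)
  open import Data.Bool using (Bool; true; false; _∧_; if_then_else_)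
  open import Data.Product using (_,_)
  open import Relation.Nullary using (¬_; yes; no; contradiction)
  open import Relation.Nullary.Decidable using (⌊_⌋; isYes≗does; dec-true; dec-false)
  open import Relation.Binary.PropositionalEquality
  open Approximation

  indicator : Bool → ℕ
  indicator c = if c then 1 else 0

  indicator≤1 : ∀ c → indicator c ≤ 1
  indicator≤1 true = ≤-refl
  indicator≤1 false = z≤n

  indicator-mono : ∀ {c d} → (c ≡ true → d ≡ true) → indicator c ≤ indicator d
  indicator-mono {false} _ = z≤n
  indicator-mono {true} c⇒d rewrite c⇒d refl = ≤-refl

  sumFin : ∀ n → (Fin n → ℕ) → ℕ
  sumFin zero f = 0
  sumFin (suc n) f = f Fin.zero + sumFin n (λ c → f (Fin.suc c))

  sumFin-cong : ∀ n {f g : Fin n → ℕ} → (∀ c → f c ≡ g c) → sumFin n f ≡ sumFin n g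
  sumFin-cong zero f≡g = refl
  sumFin-cong (suc n) f≡g = cong₂ _+_ (f≡g Fin.zero) (sumFin-cong n (λ c → f≡g (Fin.suc c)))

  sumFin-+ : ∀ n (f g : Fin n → ℕ) → sumFin n (λ c → f c + g c) ≡ sumFin n f + sumFin n g
  sumFin-+ zero f g = refl
  sumFin-+ (suc n) f g = trans (cong (f Fin.zero + g Fin.zero +_) (sumFin-+ n (λ c → f (Fin.suc c)) (λ c → g (Fin.suc c))))
    (interchange (f Fin.zero) (g Fin.zero) _ _)

  sumFin-*ʳ : ∀ n (f : Fin n → ℕ) a → sumFin n (λ c → f c * a) ≡ sumFin n f * a
  sumFin-*ʳ zero f a = refl
  sumFin-*ʳ (suc n) f a = trans (cong (f Fin.zero * a +_) (sumFin-*ʳ n (λ c → f (Fin.suc c)) a))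
    (sym (*-distribʳ-+ a (f Fin.zero) _))

  sumFin-zero : ∀ n {f : Fin n → ℕ} → (∀ c → f c ≡ 0) → sumFin n f ≡ 0
  sumFin-zero zero f≡0 = refl
  sumFin-zero (suc n) f≡0 = cong₂ _+_ (f≡0 Fin.zero) (sumFin-zero n (λ c → f≡0 (Fin.suc c)))

  sumFin-single : ∀ n (f : Fin n → ℕ) d → (∀ c → ¬ c ≡ d → f c ≡ 0) → sumFin n f ≡ f d
  sumFin-single (suc n) f Fin.zero f≡0 =
    trans (cong (f Fin.zero +_) (sumFin-zero n (λ c → f≡0 (Fin.suc c) (λ ())))) (+-identityʳ _)
  sumFin-single (suc n) f (Fin.suc d) f≡0 =
    cong₂ _+_ (f≡0 Fin.zero (λ ())) (sumFin-single n (λ c → f (Fin.suc c)) d (λ c c≢d → f≡0 (Fin.suc c) (c≢d ∘ Finₚ.suc-injective)))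

  sumFin-Near : ∀ n {f : Fin n → ℕ} {y e} → (∀ c → Near (f c) y e) → Near (sumFin n f) (n * y) (n * e)
  sumFin-Near zero near = z≤n , z≤n
  sumFin-Near (suc n) near = Near-+ (near Fin.zero) (sumFin-Near n (λ c → near (Fin.suc c)))

  module _ {b : ℕ} where

    isPrefix-++ : ∀ (u s t : Str b) → isPrefix u s ≡ true → isPrefix u (s ++ t) ≡ true
    isPrefix-++ [] s t _ = refl
    isPrefix-++ (x ∷ u) (y ∷ s) t u⊑s with x ≟ y
    ... | yes _ = isPrefix-++ u s t u⊑s
    ... | no _ = u⊑s

    isPrefix-++-≤ : ∀ (u s t : Str b) → length u ≤ length s → isPrefix u (s ++ t) ≡ isPrefix u s
    isPrefix-++-≤ [] s t _ = refl
    isPrefix-++-≤ (x ∷ u) (y ∷ s) t (s≤s u≤s) with x ≟ y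
    ... | yes _ = isPrefix-++-≤ u s t u≤s
    ... | no _ = refl

    ν≤1+length : ∀ (u s : Str b) → ν u s ≤ suc (length s)
    ν≤1+length u [] = indicator≤1 (isPrefix u [])
    ν≤1+length u (c ∷ s) = +-mono-≤ (indicator≤1 (isPrefix u (c ∷ s))) (ν≤1+length u s)

    -- The position |x| is counted both in x and in y.
    ν-++-superadditive : ∀ (u x y : Str b) → ν u x + ν u y ≤ ν u (x ++ y) + 1
    ν-++-superadditive u [] y = ≤-trans (+-monoˡ-≤ (ν u y) (indicator≤1 (isPrefix u []))) (≤-reflexive (+-comm 1 (ν u y)))
    ν-++-superadditive u (c ∷ x) y = begin
      indicator (isPrefix u (c ∷ x)) + ν u x + ν u y          ≡⟨ +-assoc (indicator (isPrefix u (c ∷ x))) (ν u x) (ν u y) ⟩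
      indicator (isPrefix u (c ∷ x)) + (ν u x + ν u y)        ≤⟨ +-mono-≤ (indicator-mono (isPrefix-++ u (c ∷ x) y)) (ν-++-superadditive u x y) ⟩
      indicator (isPrefix u (c ∷ x ++ y)) + (ν u (x ++ y) + 1) ≡⟨ sym (+-assoc (indicator (isPrefix u (c ∷ x ++ y))) (ν u (x ++ y)) 1) ⟩
      ν u (c ∷ x ++ y) + 1                                    ∎
      where open ≤-Reasoning

    ν-++-≤-length : ∀ (u x y : Str b) → ν u (x ++ y) ≤ length x + ν u y
    ν-++-≤-length u [] y = ≤-refl
    ν-++-≤-length u (c ∷ x) y = +-mono-≤ (indicator≤1 (isPrefix u (c ∷ x ++ y))) (ν-++-≤-length u x y)

    ν-++-subadditive : ∀ (u x y : Str b) → ν u (x ++ y) ≤ ν u x + ν u y + length u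
    ν-++-subadditive u x y with length x ≤? length u
    ... | yes x≤u = begin
      ν u (x ++ y)           ≤⟨ ν-++-≤-length u x y ⟩
      length x + ν u y       ≤⟨ +-monoˡ-≤ (ν u y) x≤u ⟩
      length u + ν u y       ≡⟨ +-comm (length u) (ν u y) ⟩
      ν u y + length u       ≤⟨ +-monoˡ-≤ (length u) (m≤n+m (ν u y) (ν u x)) ⟩
      ν u x + ν u y + length u ∎
      where open ≤-Reasoning
    ν-++-subadditive u [] y | no x≰u = contradiction z≤n x≰u
    ν-++-subadditive u (c ∷ x) y | no x≰u
      rewrite isPrefix-++-≤ u (c ∷ x) y (<⇒≤ (≰⇒> x≰u)) = begin
        i + ν u (x ++ y)              ≤⟨ +-monoʳ-≤ i (ν-++-subadditive u x y) ⟩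
        i + (ν u x + ν u y + length u) ≡⟨ solve-assoc ⟩
        i + ν u x + ν u y + length u  ∎
      where
      open ≤-Reasoning
      i : ℕ
      i = indicator (isPrefix u (c ∷ x))
      solve-assoc : i + (ν u x + ν u y + length u) ≡ i + ν u x + ν u y + length u
      solve-assoc = trans (sym (+-assoc i (ν u x + ν u y) (length u))) (cong (_+ length u) (sym (+-assoc i (ν u x) (ν u y))))

    ν-++-Near : ∀ (u x y : Str b) → Near (ν u (x ++ y)) (ν u x + ν u y) (suc (length u))
    ν-++-Near u x y =
      ≤-trans (ν-++-subadditive u x y) (+-monoʳ-≤ (ν u x + ν u y) (n≤1+n (length u))) ,
      ≤-trans (ν-++-superadditive u x y) (+-monoʳ-≤ (ν u (x ++ y)) (s≤s z≤n))

    sumStr : ℕ → (Str b → ℕ) → ℕ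
    sumStr zero f = f []
    sumStr (suc r) f = sumFin b (λ c → sumStr r (λ x → f (c ∷ x)))

    sumStr-cong : ∀ r {f g : Str b → ℕ} → (∀ x → f x ≡ g x) → sumStr r f ≡ sumStr r g
    sumStr-cong zero f≡g = f≡g []
    sumStr-cong (suc r) f≡g = sumFin-cong b (λ c → sumStr-cong r (λ x → f≡g (c ∷ x)))

    sumStr-+ : ∀ r (f g : Str b → ℕ) → sumStr r (λ x → f x + g x) ≡ sumStr r f + sumStr r g
    sumStr-+ zero f g = refl
    sumStr-+ (suc r) f g = trans (sumFin-cong b (λ c → sumStr-+ r (λ x → f (c ∷ x)) (λ x → g (c ∷ x))))
      (sumFin-+ b (λ c → sumStr r (λ x → f (c ∷ x))) (λ c → sumStr r (λ x → g (c ∷ x))))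

    sumStr-*ʳ : ∀ r (f : Str b → ℕ) a → sumStr r (λ x → f x * a) ≡ sumStr r f * a
    sumStr-*ʳ zero f a = refl
    sumStr-*ʳ (suc r) f a = trans (sumFin-cong b (λ c → sumStr-*ʳ r (λ x → f (c ∷ x)) a))
      (sumFin-*ʳ b (λ c → sumStr r (λ x → f (c ∷ x))) a)

    sumStr-zero : ∀ r {f : Str b → ℕ} → (∀ x → f x ≡ 0) → sumStr r f ≡ 0
    sumStr-zero zero f≡0 = f≡0 []
    sumStr-zero (suc r) f≡0 = sumFin-zero b (λ c → sumStr-zero r (λ x → f≡0 (c ∷ x)))

    sumStr-Near : ∀ r {f : Str b → ℕ} {y e} → (∀ x → length x ≡ r → Near (f x) y e) →
      Near (sumStr r f) (b ^ r * y) (b ^ r * e)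
    sumStr-Near zero {y = y} {e} near = Near-resp refl (sym (*-identityˡ y)) (sym (*-identityˡ e)) (near [] refl)
    sumStr-Near (suc r) {y = y} {e} near = Near-resp refl (sym (*-assoc b (b ^ r) y)) (sym (*-assoc b (b ^ r) e))
      (sumFin-Near b (λ c → sumStr-Near r (λ x |x|≡r → near (c ∷ x) (cong suc |x|≡r))))

    sumStr-first-letter : ∀ r d (s : Str b) →
      sumFin b (λ c → sumStr r (λ x → indicator (⌊ c ≟ d ⌋ ∧ isPrefix x s))) ≡ sumStr r (λ x → indicator (isPrefix x s))
    sumStr-first-letter r d s = trans
      (sumFin-single b _ d (λ c c≢d → sumStr-zero r (λ x → cong (λ t → indicator (t ∧ isPrefix x s)) (trans (isYes≗does (c ≟ d)) (dec-false (c ≟ d) c≢d)))))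
      (sumStr-cong r (λ x → cong (λ t → indicator (t ∧ isPrefix x s)) (trans (isYes≗does (d ≟ d)) (dec-true (d ≟ d) refl))))

    sumStr-isPrefix≤1 : ∀ r (s : Str b) → sumStr r (λ x → indicator (isPrefix x s)) ≤ 1
    sumStr-isPrefix≤1 zero s = ≤-refl
    sumStr-isPrefix≤1 (suc r) [] = ≤-trans (≤-reflexive (sumFin-zero b (λ c → sumStr-zero r (λ x → refl)))) z≤n
    sumStr-isPrefix≤1 (suc r) (d ∷ s) = ≤-trans (≤-reflexive (sumStr-first-letter r d s)) (sumStr-isPrefix≤1 r s)

    sumStr-isPrefix≡1 : ∀ r (s : Str b) → r ≤ length s → sumStr r (λ x → indicator (isPrefix x s)) ≡ 1
    sumStr-isPrefix≡1 zero s _ = refl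
    sumStr-isPrefix≡1 (suc r) (d ∷ s) (s≤s r≤s) = trans (sumStr-first-letter r d s) (sumStr-isPrefix≡1 r s r≤s)

    sumStr-isPrefix-++≤ : ∀ (u : Str b) r s → sumStr r (λ x → indicator (isPrefix (u ++ x) s)) ≤ indicator (isPrefix u s)
    sumStr-isPrefix-++≤ [] r s = sumStr-isPrefix≤1 r s
    sumStr-isPrefix-++≤ (c ∷ u) r [] = ≤-reflexive (sumStr-zero r (λ x → refl))
    sumStr-isPrefix-++≤ (c ∷ u) r (d ∷ s) with c ≟ d
    ... | yes _ = sumStr-isPrefix-++≤ u r s
    ... | no _ = ≤-reflexive (sumStr-zero r (λ x → refl))

    sumStr-isPrefix-++≡ : ∀ (u : Str b) r s → length u + r ≤ length s →
      sumStr r (λ x → indicator (isPrefix (u ++ x) s)) ≡ indicator (isPrefix u s)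
    sumStr-isPrefix-++≡ [] r s r≤s = sumStr-isPrefix≡1 r s r≤s
    sumStr-isPrefix-++≡ (c ∷ u) r (d ∷ s) (s≤s u+r≤s) with c ≟ d
    ... | yes _ = sumStr-isPrefix-++≡ u r s u+r≤s
    ... | no _ = sumStr-zero r (λ x → refl)

    sumStr-ν-++-∷ : ∀ (u : Str b) r c P → sumStr r (λ x → ν (u ++ x) (c ∷ P)) ≡
      sumStr r (λ x → indicator (isPrefix (u ++ x) (c ∷ P))) + sumStr r (λ x → ν (u ++ x) P)
    sumStr-ν-++-∷ u r c P = sumStr-+ r (λ x → indicator (isPrefix (u ++ x) (c ∷ P))) (λ x → ν (u ++ x) P)

    sumStr-ν-++≤ν : ∀ (u : Str b) r P → sumStr r (λ x → ν (u ++ x) P) ≤ ν u P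
    sumStr-ν-++≤ν u r [] = sumStr-isPrefix-++≤ u r []
    sumStr-ν-++≤ν u r (c ∷ P) rewrite sumStr-ν-++-∷ u r c P =
      +-mono-≤ (sumStr-isPrefix-++≤ u r (c ∷ P)) (sumStr-ν-++≤ν u r P)

    ν≤sumStr-ν-++ : ∀ (u : Str b) r P → ν u P ≤ sumStr r (λ x → ν (u ++ x) P) + (length u + r)
    ν≤sumStr-ν-++ u r P with length u + r ≤? length P
    ν≤sumStr-ν-++ u r [] | yes u+r≤P rewrite sumStr-isPrefix-++≡ u r [] u+r≤P = m≤m+n _ _
    ν≤sumStr-ν-++ u r (c ∷ P) | yes u+r≤P rewrite sumStr-ν-++-∷ u r c P | sumStr-isPrefix-++≡ u r (c ∷ P) u+r≤P =
      ≤-trans (+-monoʳ-≤ i (ν≤sumStr-ν-++ u r P)) (≤-reflexive (sym (+-assoc i _ (length u + r))))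
      where i = indicator (isPrefix u (c ∷ P))
    ... | no u+r≰P = ≤-trans (ν≤1+length u P) (≤-trans (≰⇒> u+r≰P) (m≤n+m (length u + r) (sumStr r (λ x → ν (u ++ x) P))))

    -- An occurrence of u followed by at least r more letters extends to exactly one occurrence of some u ++ x with |x| = r.
    ν-Near-extensions : ∀ (u : Str b) r P → Near (ν u P) (sumStr r (λ x → ν (u ++ x) P)) (length u + r)
    ν-Near-extensions u r P = ν≤sumStr-ν-++ u r P , ≤-trans (sumStr-ν-++≤ν u r P) (m≤m+n (ν u P) (length u + r))

module Typicality {b : ℕ} .{{_ : NonZero b}} (u : Str b) (E : ℕ) .{{_ : NonZero E}} where
  open import Data.Nat hiding (_≟_)
  open import Data.Nat.Properties hiding (_≟_)
  open import Data.Nat.DivMod using (_/_; _%_; m≡m%n+[m/n]*n; m%n<n)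
  open import Data.Fin using (fromℕ<)
  open import Data.List using (length; take; drop; _++_; replicate)
  open import Data.List.Properties using (length-++; length-replicate)
  open import Data.Product using (_,_; proj₁; proj₂)
  import Data.Rational as ℚ
  open import Data.Rational using (0ℚ)
  open import Relation.Binary.PropositionalEquality
  open import Data.Nat.Solver using (module +-*-Solver)
  open +-*-Solver using (solve; _:+_; _:*_; _:=_; con)
  open Approximation
  open Lists
  open Occurrences
  open RationalBounds using (tightness; tightness-bounds; frequency⇒Near; Near⇒frequency; 1/ℕ)

  ℓ β A : ℕ
  ℓ = length u
  β = b ^ ℓ
  A = β + 2

  1≤β : 1 ≤ β
  1≤β = m^n>0 b ℓ

  1≤E : 1 ≤ E
  1≤E = >-nonZero⁻¹ E

  -- |ν_u(s)/|s| − b^(−ℓ)| ≤ A/(b^ℓ E) + J/|s|, multiplied through by |s| b^ℓ E.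
  record Typical (s : Str b) (J : ℕ) : Set where
    constructor typical
    field near : Near (ν u s * β * E) (length s * E) (length s * A + J * β * E)

  Typical-weaken : ∀ {s J J′} → J ≤ J′ → Typical s J → Typical s J′
  Typical-weaken {s} J≤J′ (typical near) = typical (Near-weaken (+-monoʳ-≤ (length s * A) (*-monoˡ-≤ E (*-monoˡ-≤ β J≤J′))) near)

  typical-trivially : ∀ s → Typical s (suc (length s))
  typical-trivially s = typical (ν-bound , length-bound)
    where
    L : ℕ
    L = length s
    ν-bound : ν u s * β * E ≤ L * E + (L * A + suc L * β * E)
    ν-bound = ≤-trans (*-monoˡ-≤ E (*-monoˡ-≤ β (ν≤1+length u s)))
      (≤-trans (m≤n+m _ (L * E + L * A)) (≤-reflexive (+-assoc (L * E) (L * A) _)))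
    length-bound : L * E ≤ ν u s * β * E + (L * A + suc L * β * E)
    length-bound = ≤-trans (*-monoˡ-≤ E (≤-trans (n≤1+n L) (≤-trans (≤-reflexive (sym (*-identityʳ (suc L)))) (*-monoʳ-≤ (suc L) 1≤β))))
      (≤-trans (m≤n+m _ (ν u s * β * E + L * A)) (≤-reflexive (+-assoc (ν u s * β * E) (L * A) _)))

  Typical-++ : ∀ {x y Jx Jy} → Typical x Jx → Typical y Jy → Typical (x ++ y) (Jx + Jy + suc ℓ)
  Typical-++ {x} {y} {Jx} {Jy} (typical near-x) (typical near-y) = typical (Near-resp refl length≡ error≡
    (Near-trans (Near-*ʳ E (Near-*ʳ β (ν-++-Near u x y)))
      (Near-resp (sym (distrib (ν u x) (ν u y))) refl refl (Near-+ near-x near-y))))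
    where
    X Y : ℕ
    X = length x
    Y = length y
    distrib : ∀ a c → (a + c) * β * E ≡ a * β * E + c * β * E
    distrib a c = solve 4 (λ a c β E → (a :+ c) :* β :* E := a :* β :* E :+ c :* β :* E) refl a c β E
    length≡ : X * E + Y * E ≡ length (x ++ y) * E
    length≡ = trans (sym (*-distribʳ-+ E X Y)) (cong (_* E) (sym (length-++ x)))
    error≡ : suc ℓ * β * E + (X * A + Jx * β * E + (Y * A + Jy * β * E)) ≡ length (x ++ y) * A + (Jx + Jy + suc ℓ) * β * E
    error≡ = trans (solve 8 (λ l β E X Y A Jx Jy →
                (con 1 :+ l) :* β :* E :+ (X :* A :+ Jx :* β :* E :+ (Y :* A :+ Jy :* β :* E))
                  := (X :+ Y) :* A :+ (Jx :+ Jy :+ (con 1 :+ l)) :* β :* E) refl ℓ β E X Y A Jx Jy)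
             (cong (λ n → n * A + (Jx + Jy + suc ℓ) * β * E) (sym (length-++ x)))

  typical-from-extensions : ∀ k P → ℓ ≤ k → 1 ≤ k → k ≤ length P → 2 * k * E ≤ suc (length P ∸ k) →
    (∀ x → length x ≡ k ∸ ℓ →
      Near (ν (u ++ x) P * b ^ k * E) (suc (length P ∸ k) * E) (suc (length P ∸ k))) →
    Typical P 0
  typical-from-extensions k P ℓ≤k 1≤k k≤L 2kE≤q near-extension = typical (Near-resp refl refl (sym (+-identityʳ (L * A)))
      (Near-weaken error≤ (Near-trans (Near-trans νβE≈SβE SβE≈qE) (Near-*ʳ E q≈L))))
    where
    open ≤-Reasoning
    r L q S : ℕ
    r = k ∸ ℓ
    L = length P
    q = suc (L ∸ k)
    S = sumStr r (λ x → ν (u ++ x) P)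
    ℓ+r≡k : ℓ + r ≡ k
    ℓ+r≡k = m+[n∸m]≡n ℓ≤k
    instance
      b^r≢0 : NonZero (b ^ r)
      b^r≢0 = >-nonZero (m^n>0 b r)
    sum≡ : sumStr r (λ x → ν (u ++ x) P * b ^ k * E) ≡ b ^ r * (S * β * E)
    sum≡ = begin-equality
      sumStr r (λ x → ν (u ++ x) P * b ^ k * E)  ≡⟨ sumStr-*ʳ r (λ x → ν (u ++ x) P * b ^ k) E ⟩
      sumStr r (λ x → ν (u ++ x) P * b ^ k) * E  ≡⟨ cong (_* E) (sumStr-*ʳ r (λ x → ν (u ++ x) P) (b ^ k)) ⟩
      S * b ^ k * E                              ≡⟨ cong (λ t → S * b ^ t * E) (sym ℓ+r≡k) ⟩
      S * b ^ (ℓ + r) * E                        ≡⟨ cong (λ t → S * t * E) (^-distribˡ-+-* b ℓ r) ⟩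
      S * (β * b ^ r) * E                        ≡⟨ solve 4 (λ S β c E → S :* (β :* c) :* E := c :* (S :* β :* E)) refl S β (b ^ r) E ⟩
      b ^ r * (S * β * E)                        ∎
    SβE≈qE : Near (S * β * E) (q * E) q
    SβE≈qE = Near-*-cancelˡ (b ^ r) (Near-resp sum≡ refl refl
      (sumStr-Near r (λ x |x|≡r → near-extension x |x|≡r)))
    νβE≈SβE : Near (ν u P * β * E) (S * β * E) (k * β * E)
    νβE≈SβE = Near-*ʳ E (Near-*ʳ β (Near-resp refl refl ℓ+r≡k (ν-Near-extensions u r P)))
    q+k≡1+L : q + k ≡ suc L
    q+k≡1+L = cong suc (m∸n+n≡m k≤L)
    q≤L : q ≤ L
    q≤L = ≤-pred (begin
      suc q    ≡⟨ +-comm 1 q ⟩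
      q + 1    ≤⟨ +-monoʳ-≤ q 1≤k ⟩
      q + k    ≡⟨ q+k≡1+L ⟩
      suc L    ∎)
    q≈L : Near q L k
    q≈L = ≤-trans q≤L (m≤m+n L k) , ≤-trans (n≤1+n L) (≤-reflexive (sym q+k≡1+L))
    kE≤L : k * E ≤ L
    kE≤L = begin
      k * E          ≤⟨ m≤m+n (k * E) (k * E + 0) ⟩
      2 * (k * E)    ≡⟨ sym (*-assoc 2 k E) ⟩
      2 * k * E      ≤⟨ 2kE≤q ⟩
      q              ≤⟨ q≤L ⟩
      L              ∎
    error≤ : k * β * E + q + k * E ≤ L * A
    error≤ = begin
      k * β * E + q + k * E    ≡⟨ cong (λ t → t + q + k * E) (solve 3 (λ k β E → k :* β :* E := β :* (k :* E)) refl k β E) ⟩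
      β * (k * E) + q + k * E  ≤⟨ +-mono-≤ (+-mono-≤ (*-monoʳ-≤ β kE≤L) q≤L) kE≤L ⟩
      β * L + L + L            ≡⟨ solve 2 (λ β L → β :* L :+ L :+ L := L :* (β :+ con 2)) refl β L ⟩
      L * A                    ∎

  εkmNormal⇒k≤m : ∀ {ε k m} {w : Str b} → εkmNormal ε k m w → m ≤ length w → k ≤ m
  εkmNormal⇒k≤m {ε} {k} {m} {w} normal m≤w =
    subst₂ _≤_ (length-replicate k) (trans (length-take≡n (1 * m) w 1m≤w) (*-identityˡ m))
      (proj₁ (normal 0 1m≤w (replicate k (fromℕ< (>-nonZero⁻¹ b))) (length-replicate k)))
    where
    1m≤w : 1 * m ≤ length w
    1m≤w = subst (_≤ length w) (sym (*-identityˡ m)) m≤w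

  typical-normal-block : ∀ {ε k m} (w : Str b) → 0ℚ ℚ.< ε → 1 ≤ k → ℓ ≤ k → k ≤ m →
    ℚ.∣ tightness b ε k m ∣ ℚ.≤ 1/ℕ E → εkmNormal ε k m w →
    ∀ t → suc t * m ≤ length w → Typical (take (suc t * m) w) 0
  typical-normal-block {ε} {k} {m} w 0<ε 1≤k ℓ≤k k≤m tight normal t tm≤w =
    typical-from-extensions k P ℓ≤k 1≤k (≤-trans k≤m m≤L) 2kE≤q near-extension
    where
    P : Str b
    P = take (suc t * m) w
    L : ℕ
    L = length P
    m≤L : m ≤ L
    m≤L = subst (m ≤_) (sym (length-take≡n (suc t * m) w tm≤w)) (m≤m+n m (t * m))
    b^kε≤1/E : ℕ→ℚ (b ^ k) ℚ.* ε ℚ.≤ 1/ℕ E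
    b^kε≤1/E = proj₁ (tightness-bounds b ε k m E k≤m 1≤E 0<ε tight)
    2kE≤q : 2 * k * E ≤ suc (L ∸ k)
    2kE≤q = ≤-trans (proj₂ (tightness-bounds b ε k m E k≤m 1≤E 0<ε tight)) (s≤s (∸-monoˡ-≤ k m≤L))
    near-extension : ∀ x → length x ≡ k ∸ ℓ →
      Near (ν (u ++ x) P * b ^ k * E) (suc (L ∸ k) * E) (suc (L ∸ k))
    near-extension x |x|≡k-ℓ =
      frequency⇒Near (ν (u ++ x) P) (suc (L ∸ k)) (b ^ k) E ε (s≤s z≤n) (m^n>0 b k) 1≤E close b^kε≤1/E
      where
      |ux|≡k : length (u ++ x) ≡ k
      |ux|≡k = trans (length-++ u) (trans (cong (ℓ +_) |x|≡k-ℓ) (m+[n∸m]≡n ℓ≤k))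
      close : ℚ.∣ divQ (ℕ→ℚ (ν (u ++ x) P)) (ℕ→ℚ (suc (L ∸ k))) ℚ.- 1/ℕ (b ^ k) ∣ ℚ.≤ ε
      close = subst (λ n → ℚ.∣ divQ (ℕ→ℚ (ν (u ++ x) P)) (ℕ→ℚ (suc (L ∸ n))) ℚ.- 1/ℕ (b ^ n) ∣ ℚ.≤ ε) |ux|≡k
                (proj₂ (normal t tm≤w (u ++ x) |ux|≡k))

  typical-normal-take-*+ : ∀ {ε k m} (w : Str b) → 0ℚ ℚ.< ε → 1 ≤ k → ℓ ≤ k →
    ℚ.∣ tightness b ε k m ∣ ℚ.≤ 1/ℕ E → εkmNormal ε k m w →
    ∀ t r → r < m → t * m + r ≤ length w → Typical (take (t * m + r) w) (m + suc ℓ)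
  typical-normal-take-*+ {m = m} w 0<ε 1≤k ℓ≤k tight normal zero r r<m _ =
    Typical-weaken (≤-trans (s≤s (length-take≤n r w)) (≤-trans r<m (m≤m+n m (suc ℓ)))) (typical-trivially (take r w))
  typical-normal-take-*+ {k = k} {m = m} w 0<ε 1≤k ℓ≤k tight normal (suc t) r r<m tm+r≤w =
    subst (λ s → Typical s (m + suc ℓ)) (sym (take-+ (suc t * m) r w))
      (Typical-weaken defect≤ (Typical-++ (typical-normal-block w 0<ε 1≤k ℓ≤k k≤m tight normal t tm≤w)
                                          (typical-trivially rest)))
    where
    rest : Str b
    rest = take r (drop (suc t * m) w)
    tm≤w : suc t * m ≤ length w
    tm≤w = ≤-trans (m≤m+n (suc t * m) r) tm+r≤w
    k≤m : k ≤ m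
    k≤m = εkmNormal⇒k≤m normal (≤-trans (m≤m+n m (t * m)) tm≤w)
    defect≤ : 0 + suc (length rest) + suc ℓ ≤ m + suc ℓ
    defect≤ = +-monoˡ-≤ (suc ℓ) (≤-trans (s≤s (length-take≤n r _)) r<m)

  typical-normal-prefix : ∀ {ε k m} .{{_ : NonZero m}} (w : Str b) → 0ℚ ℚ.< ε → 1 ≤ k → ℓ ≤ k →
    ℚ.∣ tightness b ε k m ∣ ℚ.≤ 1/ℕ E → εkmNormal ε k m w →
    ∀ p → p ≤ length w → Typical (take p w) (m + suc ℓ)
  typical-normal-prefix {m = m} w 0<ε 1≤k ℓ≤k tight normal p p≤w =
    subst (λ n → Typical (take n w) (m + suc ℓ)) (sym p≡)
      (typical-normal-take-*+ w 0<ε 1≤k ℓ≤k tight normal (p / m) (p % m) (m%n<n p m) (subst (_≤ length w) p≡ p≤w))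
    where
    p≡ : p ≡ p / m * m + p % m
    p≡ = trans (m≡m%n+[m/n]*n p m) (+-comm (p % m) _)

  typical⇒frequency : ∀ D {s J} → E ≡ D * (2 * A) → 1 ≤ D → 1 ≤ length s → 2 * D * J ≤ length s → Typical s J →
    ℚ.∣ divQ (ℕ→ℚ (ν u s)) (ℕ→ℚ (length s)) ℚ.- 1/ℕ β ∣ ℚ.≤ 1/ℕ D
  typical⇒frequency D {s} {J} E≡DM 1≤D 1≤n 2DJ≤n (typical near) =
    Near⇒frequency (ν u s) n β D 1≤n 1≤β 1≤D (Near-*-cancelˡ M
      (Near-resp (scale (ν u s * β)) (scale n) refl (Near-weaken error≤ near)))
    where
    open ≤-Reasoning
    n M : ℕ
    n = length s
    M = 2 * A
    instance
      M≢0 : NonZero M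
      M≢0 = >-nonZero (≤-trans (≤-trans (s≤s z≤n) (m≤n+m 2 β)) (m≤n*m A 2))
    scale : ∀ x → x * E ≡ M * (x * D)
    scale x = trans (cong (x *_) E≡DM) (solve 3 (λ x D M → x :* (D :* M) := M :* (x :* D)) refl x D M)
    error≤ : n * A + J * β * E ≤ M * (n * β)
    error≤ = begin
      n * A + J * β * E            ≡⟨ cong (λ e → n * A + J * β * e) E≡DM ⟩
      n * A + J * β * (D * M)      ≡⟨ cong (n * A +_) (solve 4 (λ J β D A → J :* β :* (D :* (con 2 :* A)) := con 2 :* D :* J :* β :* A) refl J β D A) ⟩
      n * A + 2 * D * J * β * A    ≤⟨ +-mono-≤ (*-monoˡ-≤ A (≤-trans (≤-reflexive (sym (*-identityʳ n))) (*-monoʳ-≤ n 1≤β)))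
                                               (*-monoˡ-≤ A (*-monoˡ-≤ β 2DJ≤n)) ⟩
      n * β * A + n * β * A        ≡⟨ solve 3 (λ n β A → n :* β :* A :+ n :* β :* A := con 2 :* A :* (n :* β)) refl n β A ⟩
      M * (n * β)                  ∎

module Concatenation {b : ℕ} .{{_ : NonZero b}} (w v : ℕ → Str b) where
  open import Data.Nat hiding (_≟_)
  open import Data.Nat.Properties hiding (_≟_)
  open import Data.List using ([]; length; take; _++_)
  open import Data.List.Properties using (length-++; take-all)
  open import Data.Product using (_,_; proj₁; proj₂; ∃-syntax)
  import Data.Rational as ℚ
  open import Data.Rational using (ℚ; 0ℚ)
  open import Relation.Nullary using (yes; no; contradiction)
  open import Relation.Binary.PropositionalEquality
  open import Data.Nat.Solver using (module +-*-Solver)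
  open +-*-Solver using (solve; _:+_; _:*_; _:=_; con)
  open Sums
  open Lists
  open RationalBounds using (tightness; 1/ℕ; 1/ℕ-pos)

  blocks : ℕ → Str b
  blocks = blocksW w v

  lw lv lb sumW sumV : ℕ → ℕ
  lw j = length (w j)
  lv j = length (v j)
  lb i = length (blocks i)
  sumW = sumBelow lw
  sumV = sumBelow lv

  lb≡sumBelow : ∀ i → lb i ≡ sumBelow (λ j → lw j + lv j) i
  lb≡sumBelow i = trans (length-concatBelow (λ j → w j ++ v j) i) (sumBelow-cong (λ j → length-++ (w j)) i)

  lb-suc : ∀ i → lb (suc i) ≡ lb i + (lw i + lv i)
  lb-suc i = trans (lb≡sumBelow (suc i)) (cong (_+ (lw i + lv i)) (sym (lb≡sumBelow i)))

  lb-mono-≤ : ∀ {i i′} → i ≤ i′ → lb i ≤ lb i′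
  lb-mono-≤ {i} {i′} i≤i′ = subst₂ _≤_ (sym (lb≡sumBelow i)) (sym (lb≡sumBelow i′)) (sumBelow-monoʳ-≤ _ i≤i′)

  sumW≤lb : ∀ i → sumW i ≤ lb i
  sumW≤lb i = subst (sumW i ≤_) (sym (lb≡sumBelow i)) (sumBelow-mono-≤ (λ j → m≤m+n (lw j) (lv j)) i)

  infiniteW : ∀ (m : ℕ → ℕ) → (∀ i → 1 ≤ m i) → ∃[ N ] (∀ i → N ≤ i → sumBelow m (suc i) * 1 ≤ sumW i) →
    InfiniteW w v
  infiniteW m 1≤m (N , m-sparse) n = n + N , (begin
    n                          ≤⟨ m≤m+n n N ⟩
    n + N                      ≤⟨ n≤1+n (n + N) ⟩
    suc (n + N)                ≤⟨ ≤-sumBelow 1≤m (suc (n + N)) ⟩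
    sumBelow m (suc (n + N))   ≡⟨ sym (*-identityʳ _) ⟩
    sumBelow m (suc (n + N)) * 1 ≤⟨ m-sparse (n + N) (m≤n+m N n) ⟩
    sumW (n + N)               ≤⟨ sumW≤lb (n + N) ⟩
    lb (n + N)                 ∎)
    where open ≤-Reasoning

  module Prefixes (ε : ℕ → ℚ) (k m : ℕ → ℕ)
    (0<ε : ∀ i → 0ℚ ℚ.< ε i) (1≤k : ∀ i → 1 ≤ k i) (k→∞ : TendsToInf k) (1≤m : ∀ i → 1 ≤ m i)
    {Def : ℕ → Set} (tight : TendsTo0 Def (λ i → tightness b (ε i) (k i) (m i)))
    (normal : ∀ i → εkmNormal (ε i) (k i) (m i) (w i))
    (v-sparse : ∀ X → 1 ≤ X → ∃[ N ] (∀ i → N ≤ i → sumV (suc i) * X ≤ lb i + lw i))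
    (m-sparse : ∀ X → 1 ≤ X → ∃[ N ] (∀ i → N ≤ i → sumBelow m (suc i) * X ≤ sumW i))
    (u : Str b) (D : ℕ) .{{D≢0 : NonZero D}} where

    -- With E = 2 A D the typicality bound becomes 1/(2 D b^ℓ) + J/|s|.
    E : ℕ
    E = D * (2 * (b ^ length u + 2))

    instance
      E≢0 : NonZero E
      E≢0 = m*n≢0 D (2 * (b ^ length u + 2)) {{D≢0}}
              {{m*n≢0 2 (b ^ length u + 2) {{_}} {{>-nonZero (≤-trans (s≤s z≤n) (m≤n+m 2 (b ^ length u)))}}}}

    open Typicality u E {{E≢0}}

    opaque
      J₀ : ℕ
      J₀ = proj₁ (tight (1/ℕ E) (1/ℕ-pos 1≤E)) + proj₁ (k→∞ ℓ)

      tight-from-J₀ : ∀ j → J₀ ≤ j → ℚ.∣ tightness b (ε j) (k j) (m j) ∣ ℚ.≤ 1/ℕ E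
      tight-from-J₀ j J₀≤j = proj₂ (proj₂ (tight (1/ℕ E) (1/ℕ-pos 1≤E)) j (≤-trans (m≤m+n _ _) J₀≤j))

      ℓ≤k-from-J₀ : ∀ j → J₀ ≤ j → ℓ ≤ k j
      ℓ≤k-from-J₀ j J₀≤j = proj₂ (k→∞ ℓ) j (≤-trans (m≤n+m _ _) J₀≤j)

    -- The words w j with j < J₀ need not be normal enough yet; their whole length is charged to the defect.
    early : ℕ → ℕ
    early j with j <? J₀
    ... | yes _ = lw j
    ... | no _ = 0

    early≤lw : ∀ j → early j ≤ lw j
    early≤lw j with j <? J₀
    ... | yes _ = ≤-refl
    ... | no _ = z≤n

    early-vanishes : ∀ j → J₀ ≤ j → early j ≡ 0
    early-vanishes j J₀≤j with j <? J₀
    ... | yes j<J₀ = contradiction j<J₀ (≤⇒≯ J₀≤j)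
    ... | no _ = refl

    wDefect : ℕ → ℕ
    wDefect j = m j + suc ℓ + early j

    typical-w-prefix : ∀ j p → p ≤ lw j → Typical (take p (w j)) (wDefect j)
    typical-w-prefix j p p≤w with j <? J₀
    ... | yes _ = Typical-weaken (≤-trans (s≤s (≤-trans (length-take≤n p (w j)) p≤w))
                                          (+-monoˡ-≤ (lw j) (≤-trans (s≤s z≤n) (m≤n+m (suc ℓ) (m j)))))
                    (typical-trivially (take p (w j)))
    ... | no j≮J₀ = Typical-weaken (≤-reflexive (sym (+-identityʳ _)))
                      (typical-normal-prefix {{>-nonZero (1≤m j)}} (w j) (0<ε j) (1≤k j) (ℓ≤k-from-J₀ j J₀≤j)
                        (tight-from-J₀ j J₀≤j) (normal j) p p≤w)
      where
      J₀≤j : J₀ ≤ j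
      J₀≤j = ≮⇒≥ j≮J₀

    typical-w : ∀ j → Typical (w j) (wDefect j)
    typical-w j = subst (λ s → Typical s (wDefect j)) (take-all (lw j) (w j) ≤-refl) (typical-w-prefix j (lw j) ≤-refl)

    c : ℕ
    c = 3 * ℓ + 5

    -- The overhead 3ℓ + 4 of a block is absorbed into c · m i since m i ≥ 1.
    overhead≤ : ∀ i → m i + (3 * ℓ + 4) ≤ c * m i
    overhead≤ i = begin
      m i + (3 * ℓ + 4)            ≤⟨ +-monoʳ-≤ (m i) (≤-trans (≤-reflexive (sym (*-identityʳ _))) (*-monoʳ-≤ (3 * ℓ + 4) (1≤m i))) ⟩
      m i + (3 * ℓ + 4) * m i      ≡⟨ solve 2 (λ l x → x :+ (con 3 :* l :+ con 4) :* x := (con 3 :* l :+ con 5) :* x) refl ℓ (m i) ⟩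
      c * m i                      ∎
      where open ≤-Reasoning

    blockDefect : ℕ → ℕ
    blockDefect i = 1 + sumBelow early i + sumV i + c * sumBelow m i

    blockDefect-step : ∀ i x → blockDefect i + (wDefect i + suc x + suc ℓ) + suc ℓ ≤
                               1 + sumBelow early (suc i) + (sumV i + x) + c * sumBelow m (suc i)
    blockDefect-step i x = begin
      blockDefect i + (wDefect i + suc x + suc ℓ) + suc ℓ
        ≡⟨ solve 8 (λ S V M mi l e x c → con 1 :+ S :+ V :+ c :* M :+ (mi :+ (con 1 :+ l) :+ e :+ (con 1 :+ x) :+ (con 1 :+ l)) :+ (con 1 :+ l)
                     := con 1 :+ (S :+ e) :+ (V :+ x) :+ (c :* M :+ (mi :+ (con 3 :* l :+ con 4))))
             refl (sumBelow early i) (sumV i) (sumBelow m i) (m i) ℓ (early i) x c ⟩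
      1 + sumBelow early (suc i) + (sumV i + x) + (c * sumBelow m i + (m i + (3 * ℓ + 4)))
        ≤⟨ +-monoʳ-≤ (1 + sumBelow early (suc i) + (sumV i + x)) (+-monoʳ-≤ (c * sumBelow m i) (overhead≤ i)) ⟩
      1 + sumBelow early (suc i) + (sumV i + x) + (c * sumBelow m i + c * m i)
        ≡⟨ cong (1 + sumBelow early (suc i) + (sumV i + x) +_) (sym (*-distribˡ-+ c (sumBelow m i) (m i))) ⟩
      1 + sumBelow early (suc i) + (sumV i + x) + c * sumBelow m (suc i) ∎
      where open ≤-Reasoning

    typical-blocks : ∀ i → Typical (blocks i) (blockDefect i)
    typical-blocks zero = Typical-weaken (m≤m+n 1 (c * 0)) (typical-trivially [])
    typical-blocks (suc i) = Typical-weaken (blockDefect-step i (lv i))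
      (Typical-++ (typical-blocks i) (Typical-++ (typical-w i) (typical-trivially (v i))))

    typical-block-prefix : ∀ i r → Typical (take r (w i ++ v i)) (wDefect i + suc (r ∸ lw i) + suc ℓ)
    typical-block-prefix i r with r ≤? lw i
    ... | yes r≤w = subst (λ s → Typical s (wDefect i + suc (r ∸ lw i) + suc ℓ)) (sym (take-++-≤ r (w i) (v i) r≤w))
      (Typical-weaken (≤-trans (m≤m+n (wDefect i) (suc (r ∸ lw i))) (m≤m+n _ (suc ℓ))) (typical-w-prefix i r r≤w))
    ... | no r≰w = subst (λ s → Typical s (wDefect i + suc (r ∸ lw i) + suc ℓ)) (sym (take-++-≥ r (w i) (v i) (<⇒≤ (≰⇒> r≰w))))
      (Typical-weaken (+-monoˡ-≤ (suc ℓ) (+-monoʳ-≤ (wDefect i) (s≤s (length-take≤n (r ∸ lw i) (v i)))))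
        (Typical-++ (typical-w i) (typical-trivially (take (r ∸ lw i) (v i)))))

    prefixDefect : ℕ → ℕ → ℕ
    prefixDefect i r = 1 + sumW J₀ + (sumV i + (r ∸ lw i)) + c * sumBelow m (suc i)

    typical-prefix : ∀ i r → Typical (blocks i ++ take r (w i ++ v i)) (prefixDefect i r)
    typical-prefix i r = Typical-weaken defect≤ (Typical-++ (typical-blocks i) (typical-block-prefix i r))
      where
      early≤ : sumBelow early (suc i) ≤ sumW J₀
      early≤ = sumBelow-vanishing J₀ early≤lw early-vanishes (suc i)
      defect≤ : blockDefect i + (wDefect i + suc (r ∸ lw i) + suc ℓ) + suc ℓ ≤ prefixDefect i r
      defect≤ = ≤-trans (blockDefect-step i (r ∸ lw i))
        (+-monoˡ-≤ (c * sumBelow m (suc i)) (+-monoˡ-≤ (sumV i + (r ∸ lw i)) (+-monoʳ-≤ 1 early≤)))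

    X : ℕ
    X = 2 * D * (c + 2)

    1≤X : 1 ≤ X
    1≤X = >-nonZero⁻¹ X {{m*n≢0 (2 * D) (c + 2) {{m*n≢0 2 D {{_}} {{D≢0}}}} {{>-nonZero (≤-trans (s≤s z≤n) (m≤n+m 2 c))}}}}

    Nᵥ Nₘ Nₗ : ℕ
    Nᵥ = proj₁ (v-sparse X 1≤X)
    Nₘ = proj₁ (m-sparse X 1≤X)
    Nₗ = suc (Nᵥ + Nₘ)

    threshold : ℕ
    threshold = suc (lb Nₗ) + X * (1 + sumW J₀)

    late : ∀ i r → threshold ≤ lb i + r → r ≤ lw i + lv i → Nₗ ≤ i
    late i r threshold≤n r≤ = ≮⇒≥ λ i<Nₗ → <⇒≱ (≤-trans (s≤s (m≤m+n (lb Nₗ) _)) threshold≤n) (begin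
      lb i + r               ≤⟨ +-monoʳ-≤ (lb i) r≤ ⟩
      lb i + (lw i + lv i)   ≡⟨ sym (lb-suc i) ⟩
      lb (suc i)             ≤⟨ lb-mono-≤ i<Nₗ ⟩
      lb Nₗ                  ∎)
      where open ≤-Reasoning

    v-part≤ : ∀ i r → Nₗ ≤ i → r ≤ lw i + lv i → (sumV i + (r ∸ lw i)) * X ≤ lb i + r
    v-part≤ i r Nₗ≤i r≤ with r ≤? lw i
    v-part≤ (suc i) r (s≤s Nᵥ+Nₘ≤i) r≤ | yes r≤w = begin
      (sumV (suc i) + (r ∸ lw (suc i))) * X  ≡⟨ cong (λ t → (sumV (suc i) + t) * X) (m≤n⇒m∸n≡0 r≤w) ⟩
      (sumV (suc i) + 0) * X                 ≡⟨ cong (_* X) (+-identityʳ (sumV (suc i))) ⟩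
      sumV (suc i) * X                       ≤⟨ proj₂ (v-sparse X 1≤X) i (≤-trans (m≤m+n Nᵥ Nₘ) Nᵥ+Nₘ≤i) ⟩
      lb i + lw i                            ≤⟨ +-monoʳ-≤ (lb i) (m≤m+n (lw i) (lv i)) ⟩
      lb i + (lw i + lv i)                   ≡⟨ sym (lb-suc i) ⟩
      lb (suc i)                             ≤⟨ m≤m+n (lb (suc i)) r ⟩
      lb (suc i) + r                         ∎
      where open ≤-Reasoning
    ... | no r≰w = begin
      (sumV i + (r ∸ lw i)) * X  ≤⟨ *-monoˡ-≤ X (+-monoʳ-≤ (sumV i) (≤-trans (∸-monoˡ-≤ (lw i) r≤) (≤-reflexive (m+n∸m≡n (lw i) (lv i))))) ⟩
      sumV (suc i) * X           ≤⟨ proj₂ (v-sparse X 1≤X) i (≤-trans (≤-trans (m≤m+n Nᵥ Nₘ) (n≤1+n _)) Nₗ≤i) ⟩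
      lb i + lw i                ≤⟨ +-monoʳ-≤ (lb i) (<⇒≤ (≰⇒> r≰w)) ⟩
      lb i + r                   ∎
      where open ≤-Reasoning

    m-part≤ : ∀ i r → Nₗ ≤ i → sumBelow m (suc i) * X ≤ lb i + r
    m-part≤ i r Nₗ≤i = ≤-trans (proj₂ (m-sparse X 1≤X) i (≤-trans (≤-trans (m≤n+m Nₘ Nᵥ) (n≤1+n _)) Nₗ≤i))
                               (≤-trans (sumW≤lb i) (m≤m+n (lb i) r))

    prefixDefect-small : ∀ i r → threshold ≤ lb i + r → r ≤ lw i + lv i → 2 * D * prefixDefect i r ≤ lb i + r
    prefixDefect-small i r threshold≤n r≤ = *-cancelˡ-≤ (c + 2) {{>-nonZero (≤-trans (s≤s z≤n) (m≤n+m 2 c))}} (begin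
      (c + 2) * (2 * D * prefixDefect i r)   ≡⟨ solve 3 (λ c D J → (c :+ con 2) :* (con 2 :* D :* J) := con 2 :* D :* (c :+ con 2) :* J) refl c D (prefixDefect i r) ⟩
      X * prefixDefect i r                   ≡⟨ solve 5 (λ X C V c M → X :* (con 1 :+ C :+ V :+ c :* M) := X :* (con 1 :+ C) :+ V :* X :+ c :* (M :* X))
                                                  refl X (sumW J₀) (sumV i + (r ∸ lw i)) c (sumBelow m (suc i)) ⟩
      X * (1 + sumW J₀) + (sumV i + (r ∸ lw i)) * X + c * (sumBelow m (suc i) * X)
                                             ≤⟨ +-mono-≤ (+-mono-≤ constant-part≤ (v-part≤ i r Nₗ≤i r≤)) (*-monoʳ-≤ c (m-part≤ i r Nₗ≤i)) ⟩
      n + n + c * n                          ≡⟨ solve 2 (λ n c → n :+ n :+ c :* n := (c :+ con 2) :* n) refl n c ⟩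
      (c + 2) * n                            ∎)
      where
      open ≤-Reasoning
      n : ℕ
      n = lb i + r
      Nₗ≤i : Nₗ ≤ i
      Nₗ≤i = late i r threshold≤n r≤
      constant-part≤ : X * (1 + sumW J₀) ≤ n
      constant-part≤ = ≤-trans (m≤n+m _ (suc (lb Nₗ))) threshold≤n

    frequency-in-prefix : ∀ i r → threshold ≤ lb i + r → 1 ≤ lb i + r → r ≤ length (w i ++ v i) →
      ℚ.∣ divQ (ℕ→ℚ (ν u (blocks i ++ take r (w i ++ v i)))) (ℕ→ℚ (lb i + r)) ℚ.- 1/ℕ β ∣ ℚ.≤ 1/ℕ D
    frequency-in-prefix i r threshold≤n 1≤n r≤ =
      subst (λ L → ℚ.∣ divQ (ℕ→ℚ (ν u s)) (ℕ→ℚ L) ℚ.- 1/ℕ β ∣ ℚ.≤ 1/ℕ D) |s|≡n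
        (typical⇒frequency D refl (>-nonZero⁻¹ D {{D≢0}}) (subst (1 ≤_) (sym |s|≡n) 1≤n)
          (subst (2 * D * prefixDefect i r ≤_) (sym |s|≡n)
            (prefixDefect-small i r threshold≤n (subst (r ≤_) (length-++ (w i)) r≤)))
          (typical-prefix i r))
      where
      s : Str b
      s = blocks i ++ take r (w i ++ v i)
      |s|≡n : length s ≡ lb i + r
      |s|≡n = trans (length-++ (blocks i)) (cong (lb i +_) (length-take≡n r (w i ++ v i) r≤))

    frequency-in-prefixes : ∀ n → threshold ≤ n → 1 ≤ n → ∀ i′ → n ≤ lb i′ →
      ℚ.∣ divQ (ℕ→ℚ (ν u (take n (blocks i′)))) (ℕ→ℚ n) ℚ.- 1/ℕ β ∣ ℚ.≤ 1/ℕ D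
    frequency-in-prefixes n threshold≤n 1≤n i′ n≤lb =
      let (i , r , r≤ , n≡ , take≡) = take-concatBelow (λ j → w j ++ v j) i′ n n≤lb in
      subst₂ (λ s L → ℚ.∣ divQ (ℕ→ℚ (ν u s)) (ℕ→ℚ L) ℚ.- 1/ℕ β ∣ ℚ.≤ 1/ℕ D) (sym take≡) (sym n≡)
        (frequency-in-prefix i r (subst (threshold ≤_) n≡ threshold≤n) (subst (1 ≤_) n≡ 1≤n) r≤)

open import Data.Nat as ℕ using (ℕ; suc; _^_)
open import Data.Integer as ℤ using (+_)
open import Data.Rational as ℚ using (ℚ; 0ℚ; _<_; _+_; _*_)
open import Data.List using (length)
open import Data.Product using (_×_)
open import Relation.Nullary using (¬_)
open import Relation.Binary.PropositionalEquality using (_≡_)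
open import Data.Product using (_,_; proj₁; proj₂; ∃-syntax)
import Data.Nat.Properties as ℕₚ
import Data.Rational.Properties as ℚₚ
open RationalBounds using (1/ℕ; eventually-ratio-≤; archimedean)

proposition4p11 :
    (b : ℕ) → 2 ℕ.≤ b →
    (w v : ℕ → Str b) →
    (ε : ℕ → ℚ) → (k m : ℕ → ℕ) →
    TendsTo0
      (λ i → ¬ (length (blocksW w v i) ℕ.+ length (w i) ≡ 0))
      (λ i → divQ (ℕ→ℚ (sumBelow (λ j → length (v j)) (suc i)))
                  (ℕ→ℚ (length (blocksW w v i) ℕ.+ length (w i)))) →
    ((i : ℕ) → 0ℚ < ε i) → TendsTo0 (λ _ → ℕ.zero ≡ ℕ.zero) ε →
    ((i : ℕ) → 1 ℕ.≤ k i) → TendsToInf k →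
    ((i : ℕ) → 1 ℕ.≤ m i) → TendsToInf m →
    TendsTo0
      (λ i → ¬ (sumBelow (λ j → length (w j)) i ≡ 0))
      (λ i → divQ (ℕ→ℚ (sumBelow m (suc i)))
                  (ℕ→ℚ (sumBelow (λ j → length (w j)) i))) →
    TendsTo0
      (λ i → ¬ (ℤ.+ m i ℤ.- ℤ.+ k i ℤ.+ ℤ.+ 1 ≡ ℤ.+ 0))
      (λ i → divQ (ℕ→ℚ (2 ℕ.* k i)) (ℤ→ℚ (ℤ.+ m i ℤ.- ℤ.+ k i ℤ.+ ℤ.+ 1))
             + ℕ→ℚ (b ^ k i) * ε i) →
    ((i : ℕ) → εkmNormal (ε i) (k i) (m i) (w i)) →
    InfiniteW w v × NormalW b w v
proposition4p11 b 2≤b w v ε k m v-small 0<ε _ 1≤k k→∞ 1≤m _ m-small tight normal =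
  infiniteW m 1≤m (m-sparse 1 (ℕ.s≤s ℕ.z≤n)) , normalW
  where
  instance
    b≢0 : ℕ.NonZero b
    b≢0 = ℕ.>-nonZero (ℕₚ.≤-trans (ℕ.s≤s ℕ.z≤n) 2≤b)
  open Concatenation w v
  m-sparse : ∀ X → 1 ℕ.≤ X → ∃[ N ] (∀ i → N ℕ.≤ i → sumBelow m (suc i) ℕ.* X ℕ.≤ sumW i)
  m-sparse = eventually-ratio-≤ (λ i → sumBelow m (suc i)) sumW m-small
  v-sparse : ∀ X → 1 ℕ.≤ X → ∃[ N ] (∀ i → N ℕ.≤ i → sumV (suc i) ℕ.* X ℕ.≤ lb i ℕ.+ lw i)
  v-sparse = eventually-ratio-≤ (λ i → sumV (suc i)) (λ i → lb i ℕ.+ lw i) v-small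
  normalW : NormalW b w v
  normalW u δ 0<δ = threshold , λ n N≤n 1≤n i n≤ → ℚₚ.≤-trans (frequency-in-prefixes n N≤n 1≤n i n≤) 1/D≤δ
    where
    D : ℕ
    D = proj₁ (archimedean δ 0<δ)
    1≤D : 1 ℕ.≤ D
    1≤D = proj₁ (proj₂ (archimedean δ 0<δ))
    1/D≤δ : 1/ℕ D ℚ.≤ δ
    1/D≤δ = proj₂ (proj₂ (archimedean δ 0<δ))
    open Prefixes ε k m 0<ε 1≤k k→∞ 1≤m tight normal v-sparse m-sparse u D {{ℕ.>-nonZero 1≤D}}
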